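{- Let $q$ be a prime power, $\delta\in\mathbb{F}_{q^2}$ with $\delta^{q+1}=1$, $s(x)=x^q+\delta x$, and let $m>1$ be an integer with $\gcd(m,q-1)=1$. Then there are exactly $q^2(q-1)$ linearized polynomials $L(x)=\alpha_1x^q+\alpha_0x$ over $\mathbb{F}_{q^2}$ of rank $1$ such that $s(x)^m+L(x)$ is a (normalized) permutation polynomial of $\mathbb{F}_{q^2}$.
   Context: A linearized polynomial over $\mathbb{F}_{q^2}$ is $L(x)=\alpha_1x^q+\alpha_0x$ with $\alpha_0,\alpha_1\in\mathbb{F}_{q^2}$; its rank is that of the $\mathbb{F}_q$-linear evaluation map on the $2$-dimensional $\mathbb{F}_q$-space $\mathbb{F}_{q^2}$. A permutation polynomial of $\mathbb{F}_{q^2}$ is one whose evaluation map is a bijection; "normalized" means monic and mapping $0$ to $0$. -}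

module Defs where

open import Level using (Level; _⊔_) renaming (suc to lsuc)
open import Algebra.Bundles using (CommutativeRing)
open import Data.Nat using (ℕ; zero; suc; _≥_)
import Data.Nat as ℕ
open import Data.Nat.Primality using (Prime)
open import Data.List using (List; length)
open import Data.List.Relation.Unary.All using (All)
open import Data.List.Relation.Unary.Any using (Any)
open import Data.List.Relation.Unary.AllPairs using (AllPairs)
open import Data.Product using (Σ; ∃; _×_; _,_; proj₁; proj₂)
open import Relation.Nullary using (¬_)

IsPrimePower : ℕ → Set
IsPrimePower q = Σ ℕ λ p → Σ ℕ λ k → Prime p × k ≥ 1 × q ≡ p ℕ.^ k
  where open import Relation.Binary.PropositionalEquality using (_≡_)

-- Finite cardinality of a predicate on a type with an equivalence _≈_ :
-- there is a duplicate-free list (up to ≈) of exactly the elements satisfying P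
-- (P assumed to respect ≈ where relevant), of length n.
HasCard : ∀ {a ℓ p} {A : Set a} (_≈_ : A → A → Set ℓ) (P : A → Set p) (n : ℕ) → Set (a ⊔ ℓ ⊔ p)
HasCard {A = A} _≈_ P n =
  Σ (List A) λ xs →
    length xs ≡ n
    × AllPairs (λ x y → ¬ (x ≈ y)) xs
    × All P xs
    × (∀ x → P x → Any (x ≈_) xs)
  where open import Relation.Binary.PropositionalEquality using (_≡_)

record Field c ℓ : Set (lsuc (c ⊔ ℓ)) where
  field
    commRing : CommutativeRing c ℓ
  open CommutativeRing commRing public
  field
    1≉0     : ¬ (1# ≈ 0#)
    inverse : ∀ x → ¬ (x ≈ 0#) → ∃ λ y → (x * y) ≈ 1#

  infixr 8 _^_
  _^_ : Carrier → ℕ → Carrier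
  x ^ zero  = 1#
  x ^ suc n = x * (x ^ n)

  HasOrder : ℕ → Set (c ⊔ ℓ)
  HasOrder n = HasCard _≈_ (λ _ → Level.Lift ℓ Data.Unit.⊤) n
    where import Data.Unit

  IsBijection : (Carrier → Carrier) → Set (c ⊔ ℓ)
  IsBijection f = (∀ x y → f x ≈ f y → x ≈ y) × (∀ y → ∃ λ x → f x ≈ y)

  linearized : ℕ → Carrier → Carrier → Carrier → Carrier
  linearized q α₁ α₀ x = (α₁ * (x ^ q)) + (α₀ * x)

  -- rank of the F_q-linear map L : F_{q²} → F_{q²} is r, i.e. its image
  -- (an F_q-subspace) has exactly q^r elements
  HasRank : ℕ → (Carrier → Carrier) → ℕ → Set (c ⊔ ℓ)
  HasRank q L r = HasCard _≈_ (λ y → ∃ λ x → L x ≈ y) (q ℕ.^ r)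

  _≈²_ : Carrier × Carrier → Carrier × Carrier → Set ℓ
  (a , b) ≈² (c′ , d) = (a ≈ c′) × (b ≈ d)

-- A linearized L = α₁ x^q + α₀ x has rank 1 exactly when α₁ ≠ 0 and α₀ = α₁ ε with
-- ε^(q+1) = 1; its image is then the line {y : y^q = α₁^(q-1) ε^q y} through 0. Likewise
-- s(x)^m lies on the line y^q = Δ y, Δ = δ^(qm), and x ↦ x^m is injective on that line
-- because gcd(m, q-1) = 1. Distinct lines meet only in 0, so s^m + L is a permutation
-- unless ε = δ (then L = α₁ s, and s is not injective since its image is a line) or
-- α₁^(q-1) = Δ ε (then the whole image of s^m + L is one line). So the coefficients are
-- (α, α ε) with ε one of the q solutions of ε^(q+1) = 1 other than δ and α one of the
-- (q² - 1) - (q - 1) nonzero elements with α^(q-1) ≠ Δ ε, because x ↦ x^(q-1) maps the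
-- units onto the solutions of ζ^(q+1) = 1 with all fibres of size q - 1. In total
-- q · q(q - 1) = q²(q - 1).

module Submission where

open import Level using (0ℓ; lift)
open import Algebra.Bundles using (CommutativeRing; CommutativeMonoid; RawRing)
open import Algebra.Solver.Ring.AlmostCommutativeRing
  using (fromCommutativeRing; _-Raw-AlmostCommutative⟶_)
open import Data.Empty using (⊥-elim)
open import Data.Fin as Fin using (Fin; zero; suc)
import Data.Fin.Properties as Fin
open import Data.List as List using (List; []; _∷_; length; filter; map; _++_)
import Data.List.Properties as List
open import Data.List.Relation.Unary.All as All using (All; []; _∷_)
import Data.List.Relation.Unary.All.Properties as All
open import Data.List.Relation.Unary.Any as Any using (Any; here; there; index)
open import Data.List.Relation.Unary.AllPairs as AllPairs using (AllPairs; []; _∷_)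
import Data.List.Relation.Unary.AllPairs.Properties as AllPairsₚ
import Data.List.Membership.Setoid as SetoidMembership
import Data.List.Membership.Setoid.Properties as SetoidMembershipₚ
import Data.List.Relation.Unary.Unique.Setoid as SetoidUnique
import Data.List.Relation.Unary.Unique.Setoid.Properties as SetoidUniqueₚ
open import Data.Maybe using (Maybe; just; nothing)
open import Data.Nat as ℕ using (ℕ; zero; suc; _≤_; _<_; z≤n; s≤s)
import Data.Nat.Properties as ℕ
open import Data.Nat.ListAction using (sum)
open import Data.Product using (∃; _×_; _,_; proj₁; proj₂)
open import Data.Product.Relation.Binary.Pointwise.NonDependent using (×-setoid)
open import Data.Sum using (_⊎_; inj₁; inj₂)
open import Data.Unit using (tt)
open import Function using (_∘_)
open import Relation.Binary using (Setoid; DecSetoid)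
open import Relation.Binary.PropositionalEquality as ≡ using (_≡_)
open import Relation.Nullary using (¬_; Dec; yes; no)
import Relation.Nullary.Decidable as Dec
import Data.Nat.Primality
import Data.Nat.GCD
open import Relation.Unary using (Pred; Decidable)
open import Relation.Unary.Properties using (∁?)

open import Defs

module _ {a} {A : Set a} where
  open import Algebra.Properties.CommutativeSemigroup ℕ.+-commutativeSemigroup using (interchange)

  sum-map-+ : ∀ (f g : A → ℕ) xs → sum (map (λ x → f x ℕ.+ g x) xs) ≡ sum (map f xs) ℕ.+ sum (map g xs)
  sum-map-+ f g []       = ≡.refl
  sum-map-+ f g (x ∷ xs) = ≡.trans (≡.cong (f x ℕ.+ g x ℕ.+_) (sum-map-+ f g xs)) (interchange (f x) (g x) _ _)

  sum-map-≤ : ∀ (f : A → ℕ) {c} xs → All (λ x → f x ≤ c) xs → sum (map f xs) ≤ length xs ℕ.* c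
  sum-map-≤ f []       []           = z≤n
  sum-map-≤ f (x ∷ xs) (fx≤c ∷ f≤c) = ℕ.+-mono-≤ fx≤c (sum-map-≤ f xs f≤c)

  sum-map-≡⇒All-≡ : ∀ (f : A → ℕ) {c} xs → All (λ x → f x ≤ c) xs →
                    sum (map f xs) ≡ length xs ℕ.* c → All (λ x → f x ≡ c) xs
  sum-map-≡⇒All-≡ f []       []           _ = []
  sum-map-≡⇒All-≡ f {c} (x ∷ xs) (fx≤c ∷ f≤c) sum≡ = fx≡c ∷ sum-map-≡⇒All-≡ f xs f≤c
      (ℕ.+-cancelˡ-≡ c _ _ (≡.trans (≡.cong (ℕ._+ sum (map f xs)) (≡.sym fx≡c)) sum≡))
    where
    fx≡c : f x ≡ c
    fx≡c = ℕ.≤-antisym fx≤c (ℕ.+-cancelʳ-≤ _ c (f x) (ℕ.≤-trans (ℕ.≤-reflexive (≡.sym sum≡))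
             (ℕ.+-monoʳ-≤ (f x) (sum-map-≤ f xs f≤c))))

  length-filter+length-filter-∁ : ∀ {p} {P : Pred A p} (P? : Decidable P) xs →
                                  length (filter P? xs) ℕ.+ length (filter (∁? P?) xs) ≡ length xs
  length-filter+length-filter-∁ P? []       = ≡.refl
  length-filter+length-filter-∁ P? (x ∷ xs) with P? x
  ... | yes _ = ≡.cong suc (length-filter+length-filter-∁ P? xs)
  ... | no  _ = ≡.trans (ℕ.+-suc _ _) (≡.cong suc (length-filter+length-filter-∁ P? xs))

  length-concatMap : ∀ {b} {B : Set b} (f : A → List B) {k} xs → All (λ x → length (f x) ≡ k) xs →
                     length (List.concatMap f xs) ≡ length xs ℕ.* k
  length-concatMap f []       []             = ≡.refl
  length-concatMap f (x ∷ xs) (|fx|≡k ∷ |f|≡k) =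
    ≡.trans (List.length-++ (f x)) (≡.cong₂ ℕ._+_ |fx|≡k (length-concatMap f xs |f|≡k))

module _ where
  open import Data.Nat.Combinatorics using (_C_; nCk+nC[k+1]≡[n+1]C[k+1]; nC1≡n)
  open import Data.Nat.Combinatorics.Specification using (k>n⇒nCk≡0)
  open import Data.Nat.Divisibility using (_∣_; divides; ∣⇒≤)
  open import Data.Nat.Primality using (Prime; euclidsLemma)
  open import Data.Nat.Solver using (module +-*-Solver)
  open +-*-Solver
  open ≡.≡-Reasoning
  open import Data.Nat using (_+_; _*_)

  [1+k]*[1+n]C[1+k]≡[1+n]*nCk : ∀ n k → suc k * (suc n C suc k) ≡ suc n * (n C k)
  [1+k]*[1+n]C[1+k]≡[1+n]*nCk zero    zero    = ≡.refl
  [1+k]*[1+n]C[1+k]≡[1+n]*nCk zero    (suc k) = begin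
    suc (suc k) * (1 C suc (suc k)) ≡⟨ ≡.cong (suc (suc k) *_) (k>n⇒nCk≡0 {1} {suc (suc k)} (s≤s (s≤s z≤n))) ⟩
    suc (suc k) * 0                 ≡⟨ ℕ.*-zeroʳ (suc (suc k)) ⟩
    0                               ≡⟨ ≡.cong (1 *_) (≡.sym (k>n⇒nCk≡0 {0} {suc k} (s≤s z≤n))) ⟩
    1 * (0 C suc k)                 ∎
  [1+k]*[1+n]C[1+k]≡[1+n]*nCk (suc n) zero    = begin
    1 * (suc (suc n) C 1) ≡⟨ ℕ.*-identityˡ _ ⟩
    suc (suc n) C 1       ≡⟨ nC1≡n (suc (suc n)) ⟩
    suc (suc n)           ≡⟨ ℕ.*-identityʳ _ ⟨
    suc (suc n) * 1       ∎
  [1+k]*[1+n]C[1+k]≡[1+n]*nCk (suc n) (suc k) = begin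
    (2 + k) * ((2 + n) C (2 + k)) ≡⟨ ≡.cong ((2 + k) *_) (nCk+nC[k+1]≡[n+1]C[k+1] (suc n) (suc k)) ⟨
    (2 + k) * (A + B)             ≡⟨ solve 3 (λ k A B → (con 2 :+ k) :* (A :+ B) := A :+ (con 1 :+ k) :* A :+ (con 2 :+ k) :* B) ≡.refl k A B ⟩
    A + (1 + k) * A + (2 + k) * B ≡⟨ ≡.cong₂ (λ u v → A + u + v) ([1+k]*[1+n]C[1+k]≡[1+n]*nCk n k) ([1+k]*[1+n]C[1+k]≡[1+n]*nCk n (suc k)) ⟩
    A + (1 + n) * a + (1 + n) * b
      ≡⟨ solve 4 (λ n A a b → A :+ (con 1 :+ n) :* a :+ (con 1 :+ n) :* b := A :+ (con 1 :+ n) :* (a :+ b)) ≡.refl n A a b ⟩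
    A + (1 + n) * (a + b)         ≡⟨ ≡.cong (λ u → A + (1 + n) * u) (nCk+nC[k+1]≡[n+1]C[k+1] n k) ⟩
    A + (1 + n) * A               ≡⟨ solve 2 (λ n A → A :+ (con 1 :+ n) :* A := (con 2 :+ n) :* A) ≡.refl n A ⟩
    (2 + n) * A                   ∎
    where
    A B a b : ℕ
    A = suc n C suc k
    B = suc n C suc (suc k)
    a = n C k
    b = n C suc k

  prime∣pCk : ∀ {p} → Prime p → ∀ {k} → 0 < k → k < p → p ∣ (p C k)
  prime∣pCk {suc n} p-prime {suc k} _ k<p
    with euclidsLemma (suc k) (suc n C suc k) p-prime
           (divides (n C k) (≡.trans ([1+k]*[1+n]C[1+k]≡[1+n]*nCk n k) (ℕ.*-comm (suc n) (n C k))))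
  ... | inj₂ p∣pCk = p∣pCk
  ... | inj₁ p∣1+k = ⊥-elim (ℕ.<⇒≱ k<p (∣⇒≤ p∣1+k))


  [1+a]^2≡1+a*[2+a] : ∀ a → suc a ℕ.^ 2 ≡ suc (a ℕ.* suc (suc a))
  [1+a]^2≡1+a*[2+a] = solve 1 (λ a → (con 1 :+ a) :^ 2 := con 1 :+ a :* (con 2 :+ a)) ≡.refl

  a*[b*a]≡a^2*b : ∀ a b → a ℕ.* (b ℕ.* a) ≡ a ℕ.^ 2 ℕ.* b
  a*[b*a]≡a^2*b = solve 2 (λ a b → a :* (b :* a) := a :^ 2 :* b) ≡.refl

IsPrimePower⇒2≤ : ∀ {q} → IsPrimePower q → 2 ≤ q
IsPrimePower⇒2≤ (p , suc k , p-prime , _ , ≡.refl) =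
  ℕ.*-mono-≤ (ℕ.nonTrivial⇒n>1 p {{p-nonTrivial}}) (ℕ.m^n>0 p {{ℕ.nonTrivial⇒nonZero p {{p-nonTrivial}}}} k)
  where
  p-nonTrivial : ℕ.NonTrivial p
  p-nonTrivial = Data.Nat.Primality.prime⇒nonTrivial p-prime

module UniqueLists {a ℓ} (S : Setoid a ℓ) where
  open Setoid S
  open SetoidMembership S public using (_∈_)
  open SetoidUnique S public using (Unique)
  open import Data.List.Relation.Binary.Subset.Setoid S public using (_⊆_)

  ∈-─ : ∀ {x y ys} (x∈ys : x ∈ ys) → y ∈ ys → ¬ y ≈ x → y ∈ (ys Any.─ x∈ys)
  ∈-─ (here x≈z)   (here y≈z)   y≉x = ⊥-elim (y≉x (trans y≈z (sym x≈z)))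
  ∈-─ (here _)     (there y∈ys) y≉x = y∈ys
  ∈-─ (there _)    (here y≈z)   y≉x = here y≈z
  ∈-─ (there x∈ys) (there y∈ys) y≉x = there (∈-─ x∈ys y∈ys y≉x)

  length-─ : ∀ {x ys} (x∈ys : x ∈ ys) → length ys ≡ suc (length (ys Any.─ x∈ys))
  length-─ {ys = ys} x∈ys = List.length-removeAt′ ys (index x∈ys)

  ⊆-─ : ∀ {x xs ys} → Unique (x ∷ xs) → (x∈ys : x ∈ ys) → x ∷ xs ⊆ ys → xs ⊆ (ys Any.─ x∈ys)
  ⊆-─ (x≉xs ∷ _) x∈ys xxs⊆ys y∈xs =
    ∈-─ x∈ys (xxs⊆ys (there y∈xs)) λ y≈x → SetoidMembershipₚ.All[≉]⇒∉ S x≉xs (SetoidMembershipₚ.∈-resp-≈ S y≈x y∈xs)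

  Unique-≈⇒index≡ : ∀ {x y xs} → Unique xs → (x∈xs : x ∈ xs) (y∈xs : y ∈ xs) → x ≈ y → index x∈xs ≡ index y∈xs
  Unique-≈⇒index≡ _            (here _)     (here _)     _   = ≡.refl
  Unique-≈⇒index≡ (z≉zs ∷ _)   (here x≈z)   (there y∈zs) x≈y =
    ⊥-elim (SetoidMembershipₚ.All[≉]⇒∉ S z≉zs (SetoidMembershipₚ.∈-resp-≈ S (trans (sym x≈y) x≈z) y∈zs))
  Unique-≈⇒index≡ (z≉zs ∷ _)   (there x∈zs) (here y≈z)   x≈y =
    ⊥-elim (SetoidMembershipₚ.All[≉]⇒∉ S z≉zs (SetoidMembershipₚ.∈-resp-≈ S (trans x≈y y≈z) x∈zs))
  Unique-≈⇒index≡ (_ ∷ zs!)    (there x∈zs) (there y∈zs) x≈y = ≡.cong suc (Unique-≈⇒index≡ zs! x∈zs y∈zs x≈y)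

  All-∈⇒⊆ : ∀ {xs ys} → All (_∈ ys) xs → xs ⊆ ys
  All-∈⇒⊆ (x∈ys ∷ _)   (here z≈x) = SetoidMembershipₚ.∈-resp-≈ S (sym z≈x) x∈ys
  All-∈⇒⊆ (_ ∷ xs⊆ys) (there z∈xs) = All-∈⇒⊆ xs⊆ys z∈xs

  Unique-⊆⇒length≤ : ∀ {xs ys} → Unique xs → xs ⊆ ys → length xs ≤ length ys
  Unique-⊆⇒length≤ {[]}     _            _      = z≤n
  Unique-⊆⇒length≤ {x ∷ xs} {ys} xxs!@(_ ∷ xs!) xxs⊆ys = ℕ.≤-trans
    (s≤s (Unique-⊆⇒length≤ xs! (⊆-─ xxs! x∈ys xxs⊆ys)))
    (ℕ.≤-reflexive (≡.sym (length-─ x∈ys)))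
    where
    x∈ys : x ∈ ys
    x∈ys = xxs⊆ys (here refl)

module DecSetoidCounting {a ℓ} (S : DecSetoid a ℓ) where
  open DecSetoid S
  open UniqueLists setoid public

  length-filter-≈ : ∀ {x xs} → Unique xs → x ∈ xs → length (filter (x ≟_) xs) ≡ 1
  length-filter-≈ {x} {xs} xs! x∈xs = ℕ.≤-antisym
    (Unique-⊆⇒length≤ (SetoidUniqueₚ.filter⁺ setoid (x ≟_) xs!) ≈x-⊆-[x])
    (SetoidMembershipₚ.∈-length setoid x∈≈x)
    where
    x≈-resp : ∀ {y z} → y ≈ z → x ≈ y → x ≈ z
    x≈-resp y≈z x≈y = trans x≈y y≈z
    ≈x-⊆-[x] : filter (x ≟_) xs ⊆ x ∷ []
    ≈x-⊆-[x] y∈ = here (sym (proj₂ (SetoidMembershipₚ.∈-filter⁻ setoid (x ≟_) x≈-resp {xs = xs} y∈)))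
    x∈≈x : x ∈ filter (x ≟_) xs
    x∈≈x = SetoidMembershipₚ.∈-filter⁺ setoid (x ≟_) x≈-resp x∈xs refl

  module _ {b} {B : Set b} (g : B → Carrier) where

    fibre : Carrier → List B → List B
    fibre y = filter (λ x → g x ≟ y)

    private
      length-fibre-∷ : ∀ x xs y → length (fibre y (x ∷ xs)) ≡ length (fibre y (x ∷ [])) ℕ.+ length (fibre y xs)
      length-fibre-∷ x xs y with g x ≟ y
      ... | yes _ = ≡.refl
      ... | no  _ = ≡.refl

      sum-length-fibre-[x] : ∀ x ys → sum (map (λ y → length (fibre y (x ∷ []))) ys) ≡ length (filter (g x ≟_) ys)
      sum-length-fibre-[x] x []       = ≡.refl
      sum-length-fibre-[x] x (y ∷ ys) with g x ≟ y
      ... | yes _ = ≡.cong suc (sum-length-fibre-[x] x ys)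
      ... | no  _ = sum-length-fibre-[x] x ys

      sum-length-fibre-[] : ∀ ys → sum (map (λ y → length (fibre y [])) ys) ≡ 0
      sum-length-fibre-[] []       = ≡.refl
      sum-length-fibre-[] (y ∷ ys) = sum-length-fibre-[] ys

    length≡sum-length-fibre : ∀ xs {ys} → Unique ys → All (λ x → g x ∈ ys) xs →
                              length xs ≡ sum (map (λ y → length (fibre y xs)) ys)
    length≡sum-length-fibre []       {ys} _   _                = ≡.sym (sum-length-fibre-[] ys)
    length≡sum-length-fibre (x ∷ xs) {ys} ys! (gx∈ys ∷ gxs∈ys) = begin
      suc (length xs)
        ≡⟨ ≡.cong₂ ℕ._+_ (≡.sym (length-filter-≈ ys! gx∈ys)) (length≡sum-length-fibre xs ys! gxs∈ys) ⟩
      length (filter (g x ≟_) ys) ℕ.+ sum (map (λ y → length (fibre y xs)) ys)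
        ≡⟨ ≡.cong (ℕ._+ _) (≡.sym (sum-length-fibre-[x] x ys)) ⟩
      sum (map (λ y → length (fibre y (x ∷ []))) ys) ℕ.+ sum (map (λ y → length (fibre y xs)) ys)
        ≡⟨ ≡.sym (sum-map-+ (λ y → length (fibre y (x ∷ []))) (λ y → length (fibre y xs)) ys) ⟩
      sum (map (λ y → length (fibre y (x ∷ [])) ℕ.+ length (fibre y xs)) ys)
        ≡⟨ ≡.cong sum (List.map-cong (≡.sym ∘ length-fibre-∷ x xs) ys) ⟩
      sum (map (λ y → length (fibre y (x ∷ xs))) ys) ∎
      where open ≡.≡-Reasoning

module CommutativeMonoidFold {c ℓ} (M : CommutativeMonoid c ℓ) where
  open CommutativeMonoid M
  open UniqueLists setoid
  open import Algebra.Properties.CommutativeSemigroup commutativeSemigroup using (x∙yz≈y∙xz)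

  fold : List Carrier → Carrier
  fold = List.foldr _∙_ ε

  fold-─ : ∀ {x ys} (x∈ys : x ∈ ys) → fold ys ≈ x ∙ fold (ys Any.─ x∈ys)
  fold-─ (here x≈y)            = ∙-congʳ (sym x≈y)
  fold-─ {x} {y ∷ ys} (there x∈ys) = trans (∙-congˡ (fold-─ x∈ys)) (x∙yz≈y∙xz y x _)

  fold-Unique-⊆ : ∀ {xs ys} → Unique xs → xs ⊆ ys → length xs ≡ length ys → fold xs ≈ fold ys
  fold-Unique-⊆ {[]}     {[]}    _              _      _    = refl
  fold-Unique-⊆ {x ∷ xs} {ys} xxs!@(_ ∷ xs!) xxs⊆ys |xxs|≡|ys| = begin
    x ∙ fold xs                 ≈⟨ ∙-congˡ (fold-Unique-⊆ xs! (⊆-─ xxs! x∈ys xxs⊆ys) |xs|≡|ys─x|) ⟩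
    x ∙ fold (ys Any.─ x∈ys)    ≈⟨ sym (fold-─ x∈ys) ⟩
    fold ys                     ∎
    where
    open import Relation.Binary.Reasoning.Setoid setoid
    x∈ys : x ∈ ys
    x∈ys = xxs⊆ys (here refl)
    |xs|≡|ys─x| : length xs ≡ length (ys Any.─ x∈ys)
    |xs|≡|ys─x| = ℕ.suc-injective (≡.trans |xxs|≡|ys| (length-─ x∈ys))

module CommutativeRingSolver {c ℓ} (R : CommutativeRing c ℓ) where
  open CommutativeRing R
  open import Algebra.Properties.Semiring.Mult semiring using (×-homo-+; ×1-homo-*) renaming (_×_ to _·_)
  open import Algebra.Properties.Ring ring using (-‿distribˡ-*; -‿distribʳ-*; -‿involutive; -0#≈0#)
  open import Algebra.Properties.AbelianGroup +-abelianGroup using (⁻¹-∙-comm)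
  open import Algebra.Properties.CommutativeSemigroup +-commutativeSemigroup using (interchange)
  open import Relation.Binary.Reasoning.Setoid setoid

  private
    -- Integer coefficients, the pair (a , b) standing for a - b: unlike elements
    -- of R they compute, so the solver can normalise and compare them.
    ℤ-as-ℕ×ℕ : RawRing 0ℓ 0ℓ
    ℤ-as-ℕ×ℕ = record
      { Carrier = ℕ × ℕ
      ; _≈_     = _≡_
      ; _+_     = λ (a , b) (a′ , b′) → (a ℕ.+ a′ , b ℕ.+ b′)
      ; _*_     = λ (a , b) (a′ , b′) → (a ℕ.* a′ ℕ.+ b ℕ.* b′ , a ℕ.* b′ ℕ.+ b ℕ.* a′)
      ; -_      = λ (a , b) → (b , a)
      ; 0#      = (0 , 0)
      ; 1#      = (1 , 0)
      }

    ⟦_⟧ℤ : ℕ × ℕ → Carrier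
    ⟦ a , b ⟧ℤ = a · 1# - b · 1#

    -‿distrib-+ : ∀ x y → - (x + y) ≈ - x + - y
    -‿distrib-+ x y = sym (⁻¹-∙-comm x y)

    -‿*-‿ : ∀ x y → - x * - y ≈ x * y
    -‿*-‿ x y = trans (sym (-‿distribˡ-* x (- y))) (trans (-‿cong (sym (-‿distribʳ-* x y))) (-‿involutive _))

    [a-b]*[c-d] : ∀ a b c d → (a - b) * (c - d) ≈ (a * c + b * d) - (a * d + b * c)
    [a-b]*[c-d] a b c d = begin
      (a - b) * (c - d)                         ≈⟨ distribʳ _ _ _ ⟩
      a * (c - d) + - b * (c - d)               ≈⟨ +-cong (distribˡ _ _ _) (distribˡ _ _ _) ⟩
      (a * c + a * - d) + (- b * c + - b * - d)
        ≈⟨ +-cong (+-congˡ (sym (-‿distribʳ-* _ _))) (+-cong (sym (-‿distribˡ-* _ _)) (-‿*-‿ b d)) ⟩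
      (a * c - a * d) + (- (b * c) + b * d)     ≈⟨ +-congˡ (+-comm _ _) ⟩
      (a * c - a * d) + (b * d - b * c)         ≈⟨ interchange _ _ _ _ ⟩
      (a * c + b * d) + (- (a * d) + - (b * c)) ≈⟨ +-congˡ (sym (-‿distrib-+ _ _)) ⟩
      (a * c + b * d) - (a * d + b * c)         ∎

    ⟦⟧-homomorphism : ℤ-as-ℕ×ℕ -Raw-AlmostCommutative⟶ fromCommutativeRing R
    ⟦⟧-homomorphism = record
      { ⟦_⟧    = ⟦_⟧ℤ
      ; +-homo = λ (a , b) (a′ , b′) → begin
          (a ℕ.+ a′) · 1# - (b ℕ.+ b′) · 1#       ≈⟨ +-cong (×-homo-+ 1# a a′) (-‿cong (×-homo-+ 1# b b′)) ⟩
          (a · 1# + a′ · 1#) - (b · 1# + b′ · 1#) ≈⟨ +-congˡ (-‿distrib-+ _ _) ⟩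
          (a · 1# + a′ · 1#) + (- (b · 1#) + - (b′ · 1#)) ≈⟨ interchange _ _ _ _ ⟩
          ⟦ a , b ⟧ℤ + ⟦ a′ , b′ ⟧ℤ                  ∎
      ; *-homo = λ (a , b) (a′ , b′) → begin
          (a ℕ.* a′ ℕ.+ b ℕ.* b′) · 1# - (a ℕ.* b′ ℕ.+ b ℕ.* a′) · 1#
            ≈⟨ +-cong (trans (×-homo-+ 1# (a ℕ.* a′) (b ℕ.* b′)) (+-cong (×1-homo-* a a′) (×1-homo-* b b′)))
                      (-‿cong (trans (×-homo-+ 1# (a ℕ.* b′) (b ℕ.* a′)) (+-cong (×1-homo-* a b′) (×1-homo-* b a′)))) ⟩
          (a · 1# * a′ · 1# + b · 1# * b′ · 1#) - (a · 1# * b′ · 1# + b · 1# * a′ · 1#)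
            ≈⟨ sym ([a-b]*[c-d] _ _ _ _) ⟩
          ⟦ a , b ⟧ℤ * ⟦ a′ , b′ ⟧ℤ ∎
      ; -‿homo = λ (a , b) → begin
          b · 1# - a · 1#      ≈⟨ +-comm _ _ ⟩
          - (a · 1#) + b · 1#  ≈⟨ +-congˡ (sym (-‿involutive _)) ⟩
          - (a · 1#) - - (b · 1#) ≈⟨ sym (-‿distrib-+ _ _) ⟩
          - ⟦ a , b ⟧ℤ          ∎
      ; 0-homo = trans (+-congˡ -0#≈0#) (+-identityʳ _)
      ; 1-homo = trans (+-cong (+-identityʳ _) -0#≈0#) (+-identityʳ _)
      }

    a-b≈c-d : ∀ {a b c d} → a + d ≈ c + b → a - b ≈ c - d
    a-b≈c-d {a} {b} {c} {d} a+d≈c+b = begin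
      a - b                   ≈⟨ sym (+-identityʳ _) ⟩
      (a - b) + 0#            ≈⟨ +-congˡ (sym (-‿inverseʳ d)) ⟩
      (a - b) + (d - d)       ≈⟨ interchange _ _ _ _ ⟩
      (a + d) + (- b + - d)   ≈⟨ +-cong a+d≈c+b (+-comm _ _) ⟩
      (c + b) + (- d + - b)   ≈⟨ interchange _ _ _ _ ⟩
      (c - d) + (b - b)       ≈⟨ +-congˡ (-‿inverseʳ b) ⟩
      (c - d) + 0#            ≈⟨ +-identityʳ _ ⟩
      c - d                   ∎

    ⟦⟧-weaklyDecidable : ∀ x y → Maybe (⟦ x ⟧ℤ ≈ ⟦ y ⟧ℤ)
    ⟦⟧-weaklyDecidable (a , b) (c , d) with a ℕ.+ d ℕ.≟ c ℕ.+ b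
    ... | yes a+d≡c+b = just (a-b≈c-d (begin
      a · 1# + d · 1# ≈⟨ sym (×-homo-+ 1# a d) ⟩
      (a ℕ.+ d) · 1#  ≡⟨ ≡.cong (_· 1#) a+d≡c+b ⟩
      (c ℕ.+ b) · 1#  ≈⟨ ×-homo-+ 1# c b ⟩
      c · 1# + b · 1# ∎))
    ... | no _ = nothing

  open import Algebra.Solver.Ring ℤ-as-ℕ×ℕ (fromCommutativeRing R) ⟦⟧-homomorphism ⟦⟧-weaklyDecidable public

module FieldProperties {c ℓ} (F : Field c ℓ) where
  open Field F public
  open CommutativeRingSolver commRing public using (solve; _:=_; _:+_; _:*_; :-_; _:-_)
  open import Algebra.Properties.Semiring.Mult semiring public using (×-homo-+; ×1-homo-*) renaming (_×_ to _·_)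
  open import Algebra.Properties.AbelianGroup +-abelianGroup public
    using () renaming (x∙y⁻¹≈ε⇒x≈y to x-y≈0⇒x≈y; x≈y⇒x∙y⁻¹≈ε to x≈y⇒x-y≈0; ⁻¹-injective to -‿injective)
  open import Relation.Binary.Reasoning.Setoid setoid public

  ^-congˡ : ∀ {x y} n → x ≈ y → x ^ n ≈ y ^ n
  ^-congˡ zero    x≈y = refl
  ^-congˡ (suc n) x≈y = *-cong x≈y (^-congˡ n x≈y)

  ^-congʳ : ∀ x {m n} → m ≡ n → x ^ m ≈ x ^ n
  ^-congʳ x m≡n = reflexive (≡.cong (x ^_) m≡n)

  ^-homo-* : ∀ x m n → x ^ (m ℕ.+ n) ≈ x ^ m * x ^ n
  ^-homo-* x zero    n = sym (*-identityˡ _)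
  ^-homo-* x (suc m) n = trans (*-congˡ (^-homo-* x m n)) (sym (*-assoc _ _ _))

  ^-distrib-* : ∀ x y n → (x * y) ^ n ≈ x ^ n * y ^ n
  ^-distrib-* x y zero    = sym (*-identityˡ _)
  ^-distrib-* x y (suc n) = begin
    (x * y) * (x * y) ^ n     ≈⟨ *-congˡ (^-distrib-* x y n) ⟩
    (x * y) * (x ^ n * y ^ n) ≈⟨ solve 4 (λ x y u v → (x :* y) :* (u :* v) := (x :* u) :* (y :* v)) refl x y (x ^ n) (y ^ n) ⟩
    (x * x ^ n) * (y * y ^ n) ∎

  ^-assocʳ : ∀ x m n → (x ^ m) ^ n ≈ x ^ (m ℕ.* n)
  ^-assocʳ x m zero    = ^-congʳ x (≡.sym (ℕ.*-zeroʳ m))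
  ^-assocʳ x m (suc n) = begin
    x ^ m * (x ^ m) ^ n       ≈⟨ *-congˡ (^-assocʳ x m n) ⟩
    x ^ m * x ^ (m ℕ.* n)     ≈⟨ sym (^-homo-* x m (m ℕ.* n)) ⟩
    x ^ (m ℕ.+ m ℕ.* n)       ≈⟨ ^-congʳ x (≡.sym (ℕ.*-suc m n)) ⟩
    x ^ (m ℕ.* suc n)         ∎

  ^-comm : ∀ x m n → (x ^ m) ^ n ≈ (x ^ n) ^ m
  ^-comm x m n = trans (^-assocʳ x m n) (trans (^-congʳ x (ℕ.*-comm m n)) (sym (^-assocʳ x n m)))

  1^n≈1 : ∀ n → 1# ^ n ≈ 1#
  1^n≈1 zero    = refl
  1^n≈1 (suc n) = trans (*-identityˡ _) (1^n≈1 n)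

  x≈0⇒x^n≈0 : ∀ {x n} → 1 ≤ n → x ≈ 0# → x ^ n ≈ 0#
  x≈0⇒x^n≈0 {n = suc _} _ x≈0 = trans (*-congʳ x≈0) (zeroˡ _)

  x^1≈x : ∀ x → x ^ 1 ≈ x
  x^1≈x = *-identityʳ

  _⁻¹ : ∀ x → ¬ x ≈ 0# → Carrier
  (x ⁻¹) x≉0 = proj₁ (inverse x x≉0)

  x*x⁻¹≈1 : ∀ x (x≉0 : ¬ x ≈ 0#) → x * (x ⁻¹) x≉0 ≈ 1#
  x*x⁻¹≈1 x x≉0 = proj₂ (inverse x x≉0)

  *-cancelˡ-≈0 : ∀ {x y} → ¬ x ≈ 0# → x * y ≈ 0# → y ≈ 0#
  *-cancelˡ-≈0 {x} {y} x≉0 xy≈0 = begin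
    y                   ≈⟨ sym (*-identityˡ y) ⟩
    1# * y              ≈⟨ *-congʳ (sym (trans (*-comm _ _) (x*x⁻¹≈1 x x≉0))) ⟩
    ((x ⁻¹) x≉0 * x) * y  ≈⟨ *-assoc _ _ _ ⟩
    (x ⁻¹) x≉0 * (x * y)  ≈⟨ *-congˡ xy≈0 ⟩
    (x ⁻¹) x≉0 * 0#       ≈⟨ zeroʳ _ ⟩
    0#                  ∎

  *-cancelˡ : ∀ {x y z} → ¬ x ≈ 0# → x * y ≈ x * z → y ≈ z
  *-cancelˡ {x} {y} {z} x≉0 xy≈xz = x-y≈0⇒x≈y y z (*-cancelˡ-≈0 x≉0 (begin
    x * (y - z)   ≈⟨ solve 3 (λ x y z → x :* (y :- z) := x :* y :- x :* z) refl x y z ⟩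
    x * y - x * z ≈⟨ x≈y⇒x-y≈0 xy≈xz ⟩
    0#            ∎))

  *-≉0 : ∀ {x y} → ¬ x ≈ 0# → ¬ y ≈ 0# → ¬ x * y ≈ 0#
  *-≉0 x≉0 y≉0 xy≈0 = y≉0 (*-cancelˡ-≈0 x≉0 xy≈0)

  ^-·1-homo : ∀ a b → (a ℕ.^ b) · 1# ≈ (a · 1#) ^ b
  ^-·1-homo a zero    = +-identityʳ 1#
  ^-·1-homo a (suc b) = trans (×1-homo-* a (a ℕ.^ b)) (*-congˡ (^-·1-homo a b))

  ^-≉0 : ∀ {x} n → ¬ x ≈ 0# → ¬ x ^ n ≈ 0#
  ^-≉0 zero    x≉0 = 1≉0
  ^-≉0 (suc n) x≉0 = *-≉0 x≉0 (^-≉0 n x≉0)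

  ≉0-resp : ∀ {x y} → x ≈ y → ¬ x ≈ 0# → ¬ y ≈ 0#
  ≉0-resp x≈y x≉0 y≈0 = x≉0 (trans x≈y y≈0)

  ay≈by⇒y≈0 : ∀ {a b y} → ¬ a ≈ b → a * y ≈ b * y → y ≈ 0#
  ay≈by⇒y≈0 {a} {b} {y} a≉b ay≈by = *-cancelˡ-≈0 (a≉b ∘ x-y≈0⇒x≈y a b) (begin
    (a - b) * y   ≈⟨ solve 3 (λ a b y → (a :- b) :* y := a :* y :- b :* y) refl a b y ⟩
    a * y - b * y ≈⟨ x≈y⇒x-y≈0 ay≈by ⟩
    0#            ∎)

  private
    ^-injective-via : ∀ {a b} i j k l → suc (i ℕ.* j) ≡ k ℕ.* l → ¬ a ≈ 0# → a ^ j ≈ b ^ j → a ^ l ≈ b ^ l → a ≈ b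
    ^-injective-via {a} {b} i j k l 1+ij≡kl a≉0 a^j≈b^j a^l≈b^l = *-cancelˡ (^-≉0 i b^j≉0) (begin
      (b ^ j) ^ i * a       ≈⟨ *-comm _ a ⟩
      a * (b ^ j) ^ i       ≈⟨ *-congˡ (^-congˡ i a^j≈b^j) ⟨
      a * (a ^ j) ^ i       ≈⟨ power a ⟩
      a ^ (k ℕ.* l)         ≈⟨ ^-comm′ a ⟩
      (a ^ l) ^ k           ≈⟨ ^-congˡ k a^l≈b^l ⟩
      (b ^ l) ^ k           ≈⟨ ^-comm′ b ⟨
      b ^ (k ℕ.* l)         ≈⟨ power b ⟨
      b * (b ^ j) ^ i       ≈⟨ *-comm b _ ⟩
      (b ^ j) ^ i * b       ∎)
      where
      b^j≉0 : ¬ b ^ j ≈ 0#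
      b^j≉0 = ≉0-resp a^j≈b^j (^-≉0 j a≉0)
      power : ∀ c → c * (c ^ j) ^ i ≈ c ^ (k ℕ.* l)
      power c = trans (*-congˡ (trans (^-assocʳ c j i) (^-congʳ c (ℕ.*-comm j i)))) (^-congʳ c 1+ij≡kl)
      ^-comm′ : ∀ c → c ^ (k ℕ.* l) ≈ (c ^ l) ^ k
      ^-comm′ c = trans (^-congʳ c (ℕ.*-comm k l)) (sym (^-assocʳ c l k))

  coprime-^-injective : ∀ {m n a b} → Data.Nat.GCD.gcd m n ≡ 1 → ¬ a ≈ 0# → a ^ m ≈ b ^ m → a ^ n ≈ b ^ n → a ≈ b
  coprime-^-injective {m} {n} gcd≡1 a≉0 a^m≈b^m a^n≈b^n
    with Data.Nat.GCD.Bézout.identity (≡.subst (Data.Nat.GCD.GCD m n) gcd≡1 (Data.Nat.GCD.gcd-GCD m n))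
  ... | Data.Nat.GCD.Bézout.+- x y 1+yn≡xm = ^-injective-via y n x m 1+yn≡xm a≉0 a^n≈b^n a^m≈b^m
  ... | Data.Nat.GCD.Bézout.-+ x y 1+xm≡yn = ^-injective-via x m y n 1+xm≡yn a≉0 a^m≈b^m a^n≈b^n

module PolynomialRoots {c ℓ} (F : Field c ℓ) where
  open FieldProperties F
  open UniqueLists setoid

  -- a₀ ∷ a₁ ∷ … ∷ aₙ₋₁ ∷ [] represents the monic polynomial a₀ + a₁ x + … + aₙ₋₁ xⁿ⁻¹ + xⁿ.
  evalMonic : List Carrier → Carrier → Carrier
  evalMonic []       x = 1#
  evalMonic (a ∷ as) x = a + x * evalMonic as x

  quotient : List Carrier → Carrier → List Carrier
  quotient []               r = []
  quotient (a ∷ [])         r = []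
  quotient (a ∷ as@(_ ∷ _)) r = evalMonic as r ∷ quotient as r

  length-quotient : ∀ a as r → length (quotient (a ∷ as) r) ≡ length as
  length-quotient a []       r = ≡.refl
  length-quotient a (b ∷ as) r = ≡.cong suc (length-quotient b as r)

  evalMonic-quotient : ∀ a as r x →
    evalMonic (a ∷ as) x ≈ (x - r) * evalMonic (quotient (a ∷ as) r) x + evalMonic (a ∷ as) r
  evalMonic-quotient a []       r x = solve 4 (λ a r x o → a :+ x :* o := (x :- r) :* o :+ (a :+ r :* o)) refl a r x 1#
  evalMonic-quotient a (b ∷ as) r x = begin
    a + x * evalMonic (b ∷ as) x ≈⟨ +-congˡ (*-congˡ (evalMonic-quotient b as r x)) ⟩
    a + x * ((x - r) * Q + ρ)
      ≈⟨ solve 5 (λ a x r Q ρ → a :+ x :* ((x :- r) :* Q :+ ρ) := (x :- r) :* (ρ :+ x :* Q) :+ (a :+ r :* ρ)) refl a x r Q ρ ⟩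
    (x - r) * (ρ + x * Q) + (a + r * ρ) ∎
    where
    Q ρ : Carrier
    Q = evalMonic (quotient (b ∷ as) r) x
    ρ = evalMonic (b ∷ as) r

  roots≤degree : ∀ as {xs} → Unique xs → All (λ x → evalMonic as x ≈ 0#) xs → length xs ≤ length as
  roots≤degree as       {[]}     _           _              = z≤n
  roots≤degree []       {x ∷ xs} _           (1≈0 ∷ _)      = ⊥-elim (1≉0 1≈0)
  roots≤degree (a ∷ as) {r ∷ xs} (r≉xs ∷ xs!) (root-r ∷ roots) =
    ≡.subst (λ n → suc (length xs) ≤ suc n) (length-quotient a as r)
      (s≤s (roots≤degree (quotient (a ∷ as) r) xs! (All.zipWith root-of-quotient (r≉xs , roots))))
    where
    root-of-quotient : ∀ {y} → ¬ r ≈ y × evalMonic (a ∷ as) y ≈ 0# → evalMonic (quotient (a ∷ as) r) y ≈ 0#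
    root-of-quotient {y} (r≉y , root-y) = *-cancelˡ-≈0 (λ y-r≈0 → r≉y (sym (x-y≈0⇒x≈y y r y-r≈0))) (begin
      (y - r) * evalMonic (quotient (a ∷ as) r) y      ≈⟨ sym (+-identityʳ _) ⟩
      (y - r) * evalMonic (quotient (a ∷ as) r) y + 0# ≈⟨ +-congˡ (sym root-r) ⟩
      (y - r) * evalMonic (quotient (a ∷ as) r) y + evalMonic (a ∷ as) r ≈⟨ sym (evalMonic-quotient a as r y) ⟩
      evalMonic (a ∷ as) y ≈⟨ root-y ⟩
      0#                   ∎)

  evalMonic-replicate-0 : ∀ n x → evalMonic (List.replicate n 0#) x ≈ x ^ n
  evalMonic-replicate-0 zero    x = refl
  evalMonic-replicate-0 (suc n) x = trans (+-identityˡ _) (*-congˡ (evalMonic-replicate-0 n x))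

  evalMonic-shift : ∀ j as x → evalMonic (List.replicate j 0# ++ as) x ≈ x ^ j * evalMonic as x
  evalMonic-shift zero    as x = sym (*-identityˡ _)
  evalMonic-shift (suc j) as x = trans (+-identityˡ _) (trans (*-congˡ (evalMonic-shift j as x)) (sym (*-assoc _ _ _)))

  solutions-x^[j+1+k]≈a*x^j-≤ : ∀ j k a {xs} → Unique xs → All (λ x → x ^ (j ℕ.+ suc k) ≈ a * x ^ j) xs →
                                 length xs ≤ j ℕ.+ suc k
  solutions-x^[j+1+k]≈a*x^j-≤ j k a xs! solutions =
    ≡.subst (_ ≤_) length-p (roots≤degree p xs! (All.map root solutions))
    where
    p : List Carrier
    p = List.replicate j 0# ++ (- a ∷ List.replicate k 0#)
    length-p : length p ≡ j ℕ.+ suc k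
    length-p = ≡.trans (List.length-++ (List.replicate j 0#))
                       (≡.cong₂ ℕ._+_ (List.length-replicate j) (≡.cong suc (List.length-replicate k)))
    root : ∀ {x} → x ^ (j ℕ.+ suc k) ≈ a * x ^ j → evalMonic p x ≈ 0#
    root {x} x^[j+1+k]≈ax^j = begin
      evalMonic p x                          ≈⟨ evalMonic-shift j _ x ⟩
      x ^ j * (- a + x * evalMonic (List.replicate k 0#) x) ≈⟨ *-congˡ (+-congˡ (*-congˡ (evalMonic-replicate-0 k x))) ⟩
      x ^ j * (- a + x ^ suc k)              ≈⟨ solve 3 (λ u a v → u :* (:- a :+ v) := u :* v :- a :* u) refl (x ^ j) a (x ^ suc k) ⟩
      x ^ j * x ^ suc k - a * x ^ j          ≈⟨ +-congʳ (sym (^-homo-* x j (suc k))) ⟩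
      x ^ (j ℕ.+ suc k) - a * x ^ j          ≈⟨ x≈y⇒x-y≈0 x^[j+1+k]≈ax^j ⟩
      0#                                     ∎

  solutions-x^[1+k]≈a-≤ : ∀ k a {xs} → Unique xs → All (λ x → x ^ suc k ≈ a) xs → length xs ≤ suc k
  solutions-x^[1+k]≈a-≤ k a xs! solutions = solutions-x^[j+1+k]≈a*x^j-≤ 0 k a xs! (All.map (λ e → trans e (sym (*-identityʳ a))) solutions)

module Frobenius {c ℓ} (F : Field c ℓ) {p} (p-prime : Data.Nat.Primality.Prime p)
                 (p·1≈0 : Field._≈_ F (FieldProperties._·_ F p (Field.1# F)) (Field.0# F)) where
  open FieldProperties F
  open import Data.Nat.Combinatorics using (_C_; nCn≡1)
  open import Data.Nat.Divisibility using (_∣_; divides)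
  open import Algebra.Properties.CommutativeSemiring.Binomial commutativeSemiring as Binomial
    using (binomialTerm)
  import Algebra.Properties.Semiring.Exp semiring as Exp
  open import Algebra.Properties.Monoid.Sum +-monoid using (sum-init-last; sum-cong-≋; sum-replicate-zero) renaming (sum to ∑)
  open import Algebra.Properties.Semiring.Mult semiring using (×-assocˡ; ×-assoc-*; ×-congʳ)

  private
    ^≈Exp^ : ∀ x m → x ^ m ≈ x Exp.^ m
    ^≈Exp^ x zero    = refl
    ^≈Exp^ x (suc m) = *-congˡ (^≈Exp^ x m)

  p∣m⇒m·x≈0 : ∀ {m} x → p ∣ m → m · x ≈ 0#
  p∣m⇒m·x≈0 {m} x (divides t m≡t*p) = begin
    m · x             ≡⟨ ≡.cong (_· x) m≡t*p ⟩
    (t ℕ.* p) · x     ≡⟨ ≡.cong (_· x) (ℕ.*-comm t p) ⟩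
    (p ℕ.* t) · x     ≈⟨ ×-assocˡ x p t ⟨
    p · (t · x)       ≈⟨ ×-congʳ p (*-identityˡ _) ⟨
    p · (1# * t · x)  ≈⟨ ×-assoc-* p 1# _ ⟨
    p · 1# * t · x    ≈⟨ *-congʳ p·1≈0 ⟩
    0# * t · x        ≈⟨ zeroˡ _ ⟩
    0#                ∎

  private
    ^[1+r]-homo-+ : ∀ r → suc r ≡ p → ∀ x y → (x + y) ^ suc r ≈ x ^ suc r + y ^ suc r
    ^[1+r]-homo-+ r ≡.refl x y = begin
      (x + y) ^ suc r                                 ≈⟨ ^≈Exp^ (x + y) (suc r) ⟩
      (x + y) Exp.^ suc r                             ≈⟨ Binomial.theorem (suc r) x y ⟩
      term Fin.zero + ∑ (term ∘ suc)                ≈⟨ +-congˡ (sum-init-last (term ∘ suc)) ⟩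
      term Fin.zero + (∑ (term ∘ suc ∘ Fin.inject₁) + term (suc (Fin.fromℕ r)))
        ≈⟨ +-congˡ (+-congʳ (trans (sum-cong-≋ middle≈0) (sum-replicate-zero r))) ⟩
      term Fin.zero + (0# + term (suc (Fin.fromℕ r))) ≈⟨ +-congˡ (+-identityˡ _) ⟩
      term Fin.zero + term (suc (Fin.fromℕ r))        ≈⟨ +-comm _ _ ⟩
      term (suc (Fin.fromℕ r)) + term Fin.zero        ≈⟨ +-cong last≈x^p first≈y^p ⟩
      x ^ suc r + y ^ suc r                           ∎
      where
      term : Fin (suc (suc r)) → Carrier
      term = binomialTerm x y (suc r)
      middle≈0 : ∀ (i : Fin r) → term (suc (Fin.inject₁ i)) ≈ 0#
      middle≈0 i = p∣m⇒m·x≈0 _ (prime∣pCk p-prime (s≤s z≤n)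
                     (s≤s (≡.subst (ℕ._< r) (≡.sym (Fin.toℕ-inject₁ i)) (Fin.toℕ<n i))))
      first≈y^p : term Fin.zero ≈ y ^ suc r
      first≈y^p = trans (+-identityʳ _) (trans (*-identityˡ _) (sym (^≈Exp^ y (suc r))))
      last≈x^p : term (suc (Fin.fromℕ r)) ≈ x ^ suc r
      last≈x^p rewrite Fin.toℕ-fromℕ r | nCn≡1 (suc r) | ℕ.n∸n≡0 r =
        trans (+-identityʳ _) (trans (*-identityʳ _) (sym (^≈Exp^ x (suc r))))

  ^p-homo-+ : ∀ x y → (x + y) ^ p ≈ x ^ p + y ^ p
  ^p-homo-+ x y = ≡.subst (λ m → (x + y) ^ m ≈ x ^ m + y ^ m) 1+[p-1]≡p (^[1+r]-homo-+ (ℕ.pred p) 1+[p-1]≡p x y)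
    where
    1+[p-1]≡p : suc (ℕ.pred p) ≡ p
    1+[p-1]≡p = ℕ.suc-pred p {{Data.Nat.Primality.prime⇒nonZero p-prime}}

  ^[p^k]-homo-+ : ∀ k x y → (x + y) ^ (p ℕ.^ k) ≈ x ^ (p ℕ.^ k) + y ^ (p ℕ.^ k)
  ^[p^k]-homo-+ zero    x y = trans (x^1≈x _) (sym (+-cong (x^1≈x x) (x^1≈x y)))
  ^[p^k]-homo-+ (suc k) x y = begin
    (x + y) ^ (p ℕ.* p ℕ.^ k)                 ≈⟨ ^-assocʳ (x + y) p (p ℕ.^ k) ⟨
    ((x + y) ^ p) ^ (p ℕ.^ k)                 ≈⟨ ^-congˡ (p ℕ.^ k) (^p-homo-+ x y) ⟩
    (x ^ p + y ^ p) ^ (p ℕ.^ k)               ≈⟨ ^[p^k]-homo-+ k (x ^ p) (y ^ p) ⟩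
    (x ^ p) ^ (p ℕ.^ k) + (y ^ p) ^ (p ℕ.^ k) ≈⟨ +-cong (^-assocʳ x p (p ℕ.^ k)) (^-assocʳ y p (p ℕ.^ k)) ⟩
    x ^ (p ℕ.* p ℕ.^ k) + y ^ (p ℕ.* p ℕ.^ k) ∎

module FiniteField {c ℓ} (F : Field c ℓ) {n} (order : Field.HasOrder F n) where
  open FieldProperties F public

  E : List Carrier
  E = proj₁ order

  length-E : length E ≡ n
  length-E = proj₁ (proj₂ order)

  E-Unique : AllPairs (λ x y → ¬ x ≈ y) E
  E-Unique = proj₁ (proj₂ (proj₂ order))

  x∈E : ∀ x → Any (x ≈_) E
  x∈E x = proj₂ (proj₂ (proj₂ (proj₂ order))) x (lift tt)

  infix 4 _≟_
  _≟_ : ∀ x y → Dec (x ≈ y)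
  x ≟ y = Dec.map′ (SetoidMembershipₚ.index-injective setoid (x∈E x) (x∈E y))
                   (UniqueLists.Unique-≈⇒index≡ setoid E-Unique (x∈E x) (x∈E y))
                   (index (x∈E x) Fin.≟ index (x∈E y))

  decSetoid : DecSetoid c ℓ
  decSetoid = record { isDecEquivalence = record { isEquivalence = isEquivalence ; _≟_ = _≟_ } }

  open DecSetoidCounting decSetoid public

  Unique⇒length≤n : ∀ {xs} → Unique xs → length xs ≤ n
  Unique⇒length≤n {xs} xs! = ≡.subst (length xs ≤_) length-E (Unique-⊆⇒length≤ xs! (λ {x} _ → x∈E x))

  injective⇒surjective : ∀ (f : Carrier → Carrier) → (∀ x y → f x ≈ f y → x ≈ y) → ∀ y → ∃ λ x → f x ≈ y
  injective⇒surjective f f-injective y with Any.any? (y ≟_) (map f E)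
  ... | yes y∈fE = let x , _ , y≈fx = SetoidMembershipₚ.∈-map⁻ setoid setoid y∈fE in x , sym y≈fx
  ... | no  y∉fE = ⊥-elim (ℕ.<⇒≱ (s≤s (ℕ.≤-reflexive |fE|≡n)) (Unique⇒length≤n y∷fE!))
    where
    |fE|≡n : n ≡ length (map f E)
    |fE|≡n = ≡.trans (≡.sym length-E) (≡.sym (List.length-map f E))
    y∷fE! : Unique (y ∷ map f E)
    y∷fE! = SetoidMembershipₚ.∉⇒All[≉] setoid y∉fE ∷ SetoidUniqueₚ.map⁺ setoid setoid (f-injective _ _) E-Unique

  module _ {p} {P : Pred Carrier p} (P? : Decidable P) where

    elementsWhere : List Carrier
    elementsWhere = filter P? E

    elementsWhere-Unique : Unique elementsWhere
    elementsWhere-Unique = SetoidUniqueₚ.filter⁺ setoid P? E-Unique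

    elementsWhere-sound : All P elementsWhere
    elementsWhere-sound = All.all-filter P? E

    elementsWhere-complete : (∀ {x y} → x ≈ y → P x → P y) → ∀ {x} → P x → x ∈ elementsWhere
    elementsWhere-complete P-resp {x} = SetoidMembershipₚ.∈-filter⁺ setoid P? P-resp (x∈E x)

    elementsWhere-sound-∈ : (∀ {x y} → x ≈ y → P x → P y) → ∀ {x} → x ∈ elementsWhere → P x
    elementsWhere-sound-∈ P-resp x∈ = proj₂ (SetoidMembershipₚ.∈-filter⁻ setoid P? P-resp {xs = E} x∈)

  image? : ∀ (f : Carrier → Carrier) → (∀ {x y} → x ≈ y → f x ≈ f y) → Decidable (λ y → ∃ λ x → f x ≈ y)
  image? f f-cong y = Dec.map′ Any.satisfied
    (λ (x , fx≈y) → Any.map (λ x≈z → trans (f-cong (sym x≈z)) fx≈y) (x∈E x))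
    (Any.any? (λ x → f x ≟ y) E)

  image-resp : ∀ (f : Carrier → Carrier) {y y′} → y ≈ y′ → (∃ λ x → f x ≈ y) → ∃ λ x → f x ≈ y′
  image-resp f y≈y′ (x , fx≈y) = x , trans fx≈y y≈y′

  x*y≈0⇒x≈0⊎y≈0 : ∀ {x y} → x * y ≈ 0# → x ≈ 0# ⊎ y ≈ 0#
  x*y≈0⇒x≈0⊎y≈0 {x} xy≈0 with x ≟ 0#
  ... | yes x≈0 = inj₁ x≈0
  ... | no  x≉0 = inj₂ (*-cancelˡ-≈0 x≉0 xy≈0)

  x^m≈0⇒x≈0 : ∀ {x} m → x ^ m ≈ 0# → x ≈ 0#
  x^m≈0⇒x≈0 zero    1≈0   = ⊥-elim (1≉0 1≈0)
  x^m≈0⇒x≈0 (suc m) x^m≈0 with x*y≈0⇒x≈0⊎y≈0 x^m≈0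
  ... | inj₁ x≈0 = x≈0
  ... | inj₂ x^m≈0 = x^m≈0⇒x≈0 m x^m≈0

  units : List Carrier
  units = elementsWhere (λ x → Dec.¬? (x ≟ 0#))

  1+length-units≡n : suc (length units) ≡ n
  1+length-units≡n = ≡.trans (≡.cong (ℕ._+ length units) 1≡|zeros|) (≡.trans (length-filter+length-filter-∁ (_≟ 0#) E) length-E)
    where
    1≡|zeros| : 1 ≡ length (filter (_≟ 0#) E)
    1≡|zeros| = ≡.trans (≡.sym (length-filter-≈ E-Unique (x∈E 0#))) (≡.cong length (List.filter-≐ (0# ≟_) (_≟ 0#) (sym , sym) E))

  private
    module ∏ = CommutativeMonoidFold *-commutativeMonoid
    module ∑ = CommutativeMonoidFold +-commutativeMonoid

  ∏-≉0 : ∀ {xs} → All (λ x → ¬ x ≈ 0#) xs → ¬ ∏.fold xs ≈ 0#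
  ∏-≉0 []          = 1≉0
  ∏-≉0 (x≉0 ∷ xs≉0) = *-≉0 x≉0 (∏-≉0 xs≉0)

  ∏-map-* : ∀ x zs → ∏.fold (map (x *_) zs) ≈ x ^ length zs * ∏.fold zs
  ∏-map-* x []       = sym (*-identityʳ _)
  ∏-map-* x (z ∷ zs) = begin
    (x * z) * ∏.fold (map (x *_) zs)      ≈⟨ *-congˡ (∏-map-* x zs) ⟩
    (x * z) * (x ^ length zs * ∏.fold zs) ≈⟨ solve 4 (λ x z u v → (x :* z) :* (u :* v) := (x :* u) :* (z :* v)) refl x z _ _ ⟩
    (x * x ^ length zs) * (z * ∏.fold zs) ∎

  x^|units|≈1 : ∀ {x} → ¬ x ≈ 0# → x ^ length units ≈ 1#
  x^|units|≈1 {x} x≉0 = *-cancelˡ (∏-≉0 units-≉0) (begin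
    ∏.fold units * x ^ length units ≈⟨ *-comm _ _ ⟩
    x ^ length units * ∏.fold units ≈⟨ ∏-map-* x units ⟨
    ∏.fold (map (x *_) units)       ≈⟨ ∏.fold-Unique-⊆ x*units-Unique x*units⊆units (List.length-map _ units) ⟩
    ∏.fold units                    ≈⟨ *-identityʳ _ ⟨
    ∏.fold units * 1#               ∎)
    where
    units-≉0 : All (λ x → ¬ x ≈ 0#) units
    units-≉0 = elementsWhere-sound _
    x*units-Unique : Unique (map (x *_) units)
    x*units-Unique = SetoidUniqueₚ.map⁺ setoid setoid (*-cancelˡ x≉0) (elementsWhere-Unique _)
    x*units⊆units : map (x *_) units ⊆ units
    x*units⊆units y∈x*units =
      let z , z∈units , y≈xz = SetoidMembershipₚ.∈-map⁻ setoid setoid y∈x*units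
      in elementsWhere-complete _ ≉0-resp (≉0-resp (sym y≈xz) (*-≉0 x≉0 (elementsWhere-sound-∈ _ ≉0-resp z∈units)))

  x^n≈x : ∀ x → x ^ n ≈ x
  x^n≈x x with x ≟ 0#
  ... | yes x≈0 = begin
    x ^ n                     ≈⟨ ^-congʳ x (≡.sym 1+length-units≡n) ⟩
    x * x ^ length units      ≈⟨ *-congʳ x≈0 ⟩
    0# * x ^ length units     ≈⟨ zeroˡ _ ⟩
    0#                        ≈⟨ sym x≈0 ⟩
    x                         ∎
  ... | no x≉0 = begin
    x ^ n                     ≈⟨ ^-congʳ x (≡.sym 1+length-units≡n) ⟩
    x * x ^ length units      ≈⟨ *-congˡ (x^|units|≈1 x≉0) ⟩
    x * 1#                    ≈⟨ *-identityʳ x ⟩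
    x                         ∎

  ∑-map-1+ : ∀ zs → ∑.fold (map (1# +_) zs) ≈ length zs · 1# + ∑.fold zs
  ∑-map-1+ []       = sym (+-identityʳ _)
  ∑-map-1+ (z ∷ zs) = begin
    (1# + z) + ∑.fold (map (1# +_) zs)          ≈⟨ +-congˡ (∑-map-1+ zs) ⟩
    (1# + z) + (length zs · 1# + ∑.fold zs)     ≈⟨ solve 4 (λ o z a b → (o :+ z) :+ (a :+ b) := (o :+ a) :+ (z :+ b)) refl 1# z _ _ ⟩
    (1# + length zs · 1#) + (z + ∑.fold zs)     ∎

  n·1≈0 : n · 1# ≈ 0#
  n·1≈0 = begin
    n · 1#                                   ≈⟨ solve 2 (λ a b → a := (a :+ b) :- b) refl _ (∑.fold E) ⟩
    (n · 1# + ∑.fold E) - ∑.fold E           ≈⟨ +-congʳ (+-congʳ (reflexive (≡.cong (_· 1#) (≡.sym length-E)))) ⟩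
    (length E · 1# + ∑.fold E) - ∑.fold E    ≈⟨ +-congʳ (∑-map-1+ E) ⟨
    ∑.fold (map (1# +_) E) - ∑.fold E        ≈⟨ +-congʳ (∑.fold-Unique-⊆ 1+E-Unique (λ {x} _ → x∈E x) (List.length-map _ E)) ⟩
    ∑.fold E - ∑.fold E                      ≈⟨ -‿inverseʳ _ ⟩
    0#                                       ∎
    where
    1+-injective : ∀ {x y} → 1# + x ≈ 1# + y → x ≈ y
    1+-injective {x} {y} 1+x≈1+y = begin
      x              ≈⟨ solve 2 (λ o x → x := (o :+ x) :- o) refl 1# x ⟩
      (1# + x) - 1#  ≈⟨ +-congʳ 1+x≈1+y ⟩
      (1# + y) - 1#  ≈⟨ solve 2 (λ o y → (o :+ y) :- o := y) refl 1# y ⟩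
      y              ∎
    1+E-Unique : Unique (map (1# +_) E)
    1+E-Unique = SetoidUniqueₚ.map⁺ setoid setoid 1+-injective E-Unique

  -‿cancelʳ : ∀ {x y} z → x - z ≈ y - z → x ≈ y
  -‿cancelʳ {x} {y} z x-z≈y-z = begin
    x             ≈⟨ solve 2 (λ x z → x := (x :- z) :+ z) refl x z ⟩
    (x - z) + z   ≈⟨ +-congʳ x-z≈y-z ⟩
    (y - z) + z   ≈⟨ solve 2 (λ y z → (y :- z) :+ z := y) refl y z ⟩
    y             ∎

  |E|≤|image|*|kernel| : ∀ (L : Carrier → Carrier) → (∀ x y → L (x - y) ≈ L x - L y) →
                         ∀ {I K} → Unique I → (∀ x → L x ∈ I) → All (λ y → ∃ λ x → L x ≈ y) I →
                         (∀ {x} → L x ≈ 0# → x ∈ K) → n ≤ length I ℕ.* length K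
  |E|≤|image|*|kernel| L L-sub {I} {K} I! L∈I I⊆image kernel⊆K =
    ≡.subst (_≤ length I ℕ.* length K) (≡.trans (≡.sym |E|≡∑|fibre|) length-E)
      (sum-map-≤ (λ y → length (fibre L y E)) I (All.map fibre≤kernel I⊆image))
    where
    |E|≡∑|fibre| : length E ≡ sum (map (λ y → length (fibre L y E)) I)
    |E|≡∑|fibre| = length≡sum-length-fibre L E I! (All.tabulate (λ {x} _ → L∈I x))
    fibre≤kernel : ∀ {y} → (∃ λ x → L x ≈ y) → length (fibre L y E) ≤ length K
    fibre≤kernel {y} (x₀ , Lx₀≈y) = ≡.subst (_≤ length K) (List.length-map (_- x₀) (fibre L y E))
      (Unique-⊆⇒length≤ (SetoidUniqueₚ.map⁺ setoid setoid (-‿cancelʳ x₀) (SetoidUniqueₚ.filter⁺ setoid _ E-Unique))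
        (All-∈⇒⊆ (All.map⁺ (All.map in-kernel (All.all-filter _ E)))))
      where
      in-kernel : ∀ {x} → L x ≈ y → x - x₀ ∈ K
      in-kernel {x} Lx≈y = kernel⊆K (trans (L-sub x x₀) (trans (+-cong Lx≈y (-‿cong Lx₀≈y)) (-‿inverseʳ y)))

module FieldOfSquareOrder {c ℓ} (F : Field c ℓ) (q : ℕ) (q-prime-power : IsPrimePower q)
                          (order : Field.HasOrder F (q ℕ.^ 2)) where
  open FiniteField F order public

  private
    p : ℕ
    p = proj₁ q-prime-power
    k : ℕ
    k = proj₁ (proj₂ q-prime-power)
    p-prime : Data.Nat.Primality.Prime p
    p-prime = proj₁ (proj₂ (proj₂ q-prime-power))
    q≡p^k : q ≡ p ℕ.^ k
    q≡p^k = proj₂ (proj₂ (proj₂ (proj₂ q-prime-power)))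

  q≡2+[q∸2] : q ≡ 2 ℕ.+ (q ℕ.∸ 2)
  q≡2+[q∸2] = ≡.sym (ℕ.m+[n∸m]≡n (IsPrimePower⇒2≤ q-prime-power))

  q≡1+[q∸1] : q ≡ suc (q ℕ.∸ 1)
  q≡1+[q∸1] = ≡.trans q≡2+[q∸2] (≡.cong (λ m → suc (m ℕ.∸ 1)) (≡.sym q≡2+[q∸2]))

  p·1≈0 : p · 1# ≈ 0#
  p·1≈0 = x^m≈0⇒x≈0 (k ℕ.* 2) (begin
    (p · 1#) ^ (k ℕ.* 2)  ≈⟨ ^-·1-homo p (k ℕ.* 2) ⟨
    (p ℕ.^ (k ℕ.* 2)) · 1# ≡⟨ ≡.cong (_· 1#) (≡.trans (≡.cong (ℕ._^ 2) q≡p^k) (ℕ.^-*-assoc p k 2)) ⟨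
    (q ℕ.^ 2) · 1#        ≈⟨ n·1≈0 ⟩
    0#                    ∎)

  open Frobenius F p-prime p·1≈0 using (^[p^k]-homo-+)

  ^q-homo-+ : ∀ x y → (x + y) ^ q ≈ x ^ q + y ^ q
  ^q-homo-+ x y = ≡.subst (λ m → (x + y) ^ m ≈ x ^ m + y ^ m) (≡.sym q≡p^k) (^[p^k]-homo-+ k x y)

  0^q≈0 : 0# ^ q ≈ 0#
  0^q≈0 = trans (^-congʳ 0# q≡1+[q∸1]) (zeroˡ _)

  -‿^q : ∀ x → (- x) ^ q ≈ - x ^ q
  -‿^q x = begin
    (- x) ^ q                   ≈⟨ solve 2 (λ a b → a := (a :+ b) :- b) refl _ (x ^ q) ⟩
    ((- x) ^ q + x ^ q) - x ^ q ≈⟨ +-congʳ (^q-homo-+ (- x) x) ⟨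
    (- x + x) ^ q - x ^ q       ≈⟨ +-congʳ (trans (^-congˡ q (-‿inverseˡ x)) 0^q≈0) ⟩
    0# - x ^ q                  ≈⟨ +-identityˡ _ ⟩
    - x ^ q                     ∎

  ^q-homo-- : ∀ x y → (x - y) ^ q ≈ x ^ q - y ^ q
  ^q-homo-- x y = trans (^q-homo-+ x (- y)) (+-congˡ (-‿^q y))

  [x^q]^q≈x : ∀ x → (x ^ q) ^ q ≈ x
  [x^q]^q≈x x = trans (^-assocʳ x q q) (trans (^-congʳ x (≡.cong (q ℕ.*_) (≡.sym (ℕ.*-identityʳ q)))) (x^n≈x x))

  q<q^2 : q < q ℕ.^ 2
  q<q^2 = ≡.subst (λ m → m < m ℕ.^ 2) (≡.sym q≡2+[q∸2])
            (ℕ.<-≤-trans (ℕ.m<m*n q′ q′ (s≤s (s≤s z≤n))) (ℕ.≤-reflexive (≡.cong (q′ ℕ.*_) (≡.sym (ℕ.*-identityʳ q′)))))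
    where
    q′ : ℕ
    q′ = 2 ℕ.+ (q ℕ.∸ 2)

  open PolynomialRoots F using (solutions-x^[j+1+k]≈a*x^j-≤; solutions-x^[1+k]≈a-≤)

  solutions-x^q≈a*x-≤q : ∀ a {xs} → Unique xs → All (λ x → x ^ q ≈ a * x) xs → length xs ≤ q
  solutions-x^q≈a*x-≤q a {xs} xs! solutions = ≡.subst (length xs ≤_) (≡.sym q≡2+[q∸2])
    (solutions-x^[j+1+k]≈a*x^j-≤ 1 (q ℕ.∸ 2) a xs!
      (All.map (λ {x} x^q≈ax → trans (^-congʳ x (≡.sym q≡2+[q∸2])) (trans x^q≈ax (*-congˡ (sym (x^1≈x x))))) solutions))

  ¬∀x^q≈a*x : ∀ a → ¬ (∀ x → x ^ q ≈ a * x)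
  ¬∀x^q≈a*x a all-solutions = ℕ.<⇒≱ q<q^2
    (≡.subst (_≤ q) length-E (solutions-x^q≈a*x-≤q a E-Unique (All.tabulate (λ {x} _ → all-solutions x))))

  ¬surjective-onto-line : ∀ (f : Carrier → Carrier) a → (∀ x → f x ^ q ≈ a * f x) → ¬ (∀ y → ∃ λ x → f x ≈ y)
  ¬surjective-onto-line f a on-line surjective = ¬∀x^q≈a*x a λ y →
    let x , fx≈y = surjective y in trans (^-congˡ q (sym fx≈y)) (trans (on-line x) (*-congˡ fx≈y))

  q∸1≡1+[q∸2] : q ℕ.∸ 1 ≡ suc (q ℕ.∸ 2)
  q∸1≡1+[q∸2] = ≡.cong (ℕ._∸ 1) q≡2+[q∸2]

  x^q≈x*x^[q∸1] : ∀ x → x ^ q ≈ x * x ^ (q ℕ.∸ 1)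
  x^q≈x*x^[q∸1] x = ^-congʳ x q≡1+[q∸1]

  length-units : length units ≡ (q ℕ.∸ 1) ℕ.* suc q
  length-units = ℕ.suc-injective (≡.trans 1+length-units≡n
    (≡.subst (λ m → m ℕ.^ 2 ≡ suc ((m ℕ.∸ 1) ℕ.* suc m)) (≡.sym q≡1+[q∸1]) ([1+a]^2≡1+a*[2+a] (q ℕ.∸ 1))))

  N : Carrier → Carrier
  N x = x ^ suc q

  N-homo-* : ∀ x y → N (x * y) ≈ N x * N y
  N-homo-* x y = ^-distrib-* x y (suc q)

  N[x^[q∸1]]≈1 : ∀ {x} → ¬ x ≈ 0# → N (x ^ (q ℕ.∸ 1)) ≈ 1#
  N[x^[q∸1]]≈1 {x} x≉0 = trans (^-assocʳ x (q ℕ.∸ 1) (suc q)) (trans (^-congʳ x (≡.sym length-units)) (x^|units|≈1 x≉0))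

  normOne : List Carrier
  normOne = elementsWhere (λ x → N x ≟ 1#)

  N≈1-resp : ∀ {x y} → x ≈ y → N x ≈ 1# → N y ≈ 1#
  N≈1-resp x≈y Nx≈1 = trans (^-congˡ (suc q) (sym x≈y)) Nx≈1

  private
    instance
      q∸1-nonZero : ℕ.NonZero (q ℕ.∸ 1)
      q∸1-nonZero = ≡.subst ℕ.NonZero (≡.sym q∸1≡1+[q∸2]) _

    fibre-size : Carrier → ℕ
    fibre-size ζ = length (fibre (_^ (q ℕ.∸ 1)) ζ units)

    fibre-size≤q∸1 : ∀ ζ → fibre-size ζ ≤ q ℕ.∸ 1
    fibre-size≤q∸1 ζ = ≡.subst (fibre-size ζ ≤_) (≡.sym q∸1≡1+[q∸2])
      (solutions-x^[1+k]≈a-≤ (q ℕ.∸ 2) ζ (SetoidUniqueₚ.filter⁺ setoid _ (elementsWhere-Unique _))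
        (All.map (λ {x} x^[q∸1]≈ζ → trans (^-congʳ x (≡.sym q∸1≡1+[q∸2])) x^[q∸1]≈ζ) (All.all-filter _ units)))

    |units|≡∑fibre-size : length units ≡ sum (map fibre-size normOne)
    |units|≡∑fibre-size = length≡sum-length-fibre (_^ (q ℕ.∸ 1)) units (elementsWhere-Unique _)
      (All.map (λ x≉0 → elementsWhere-complete _ N≈1-resp (N[x^[q∸1]]≈1 x≉0)) (elementsWhere-sound _))

    |normOne|≤1+q : length normOne ≤ suc q
    |normOne|≤1+q = solutions-x^[1+k]≈a-≤ q 1# (elementsWhere-Unique _) (elementsWhere-sound _)

    -- The units are the disjoint union of the fibres of x ↦ x^(q-1) over normOne.
    1+q≤|normOne| : suc q ≤ length normOne
    1+q≤|normOne| = ℕ.*-cancelʳ-≤ (suc q) (length normOne) (q ℕ.∸ 1) (ℕ.≤-trans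
      (ℕ.≤-reflexive (≡.trans (ℕ.*-comm (suc q) (q ℕ.∸ 1)) (≡.trans (≡.sym length-units) |units|≡∑fibre-size)))
      (sum-map-≤ fibre-size normOne (All.tabulate (λ {ζ} _ → fibre-size≤q∸1 ζ))))

  length-normOne : length normOne ≡ suc q
  length-normOne = ℕ.≤-antisym |normOne|≤1+q 1+q≤|normOne|

  length-fibre-x^[q∸1] : ∀ {ζ} → N ζ ≈ 1# → length (fibre (_^ (q ℕ.∸ 1)) ζ units) ≡ q ℕ.∸ 1
  length-fibre-x^[q∸1] {ζ} Nζ≈1 =
    let fibre-full , ζ≈ζ′ = All.lookupAny all-fibres-full (elementsWhere-complete _ N≈1-resp Nζ≈1)
    in ≡.trans (fibre-size-cong ζ≈ζ′) fibre-full
    where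
    all-fibres-full : All (λ ζ → fibre-size ζ ≡ q ℕ.∸ 1) normOne
    all-fibres-full = sum-map-≡⇒All-≡ fibre-size normOne (All.tabulate (λ {ζ} _ → fibre-size≤q∸1 ζ))
      (≡.trans (≡.sym |units|≡∑fibre-size) (≡.trans length-units
        (≡.trans (ℕ.*-comm (q ℕ.∸ 1) (suc q)) (≡.cong (ℕ._* (q ℕ.∸ 1)) (≡.sym length-normOne)))))
    fibre-size-cong : ∀ {ζ ζ′} → ζ ≈ ζ′ → fibre-size ζ ≡ fibre-size ζ′
    fibre-size-cong ζ≈ζ′ = ≡.cong length (List.filter-≐ _ _ ((λ e → trans e ζ≈ζ′) , (λ e → trans e (sym ζ≈ζ′))) units)

module LinearizedPolynomials {c ℓ} (F : Field c ℓ) (q : ℕ) (q-prime-power : IsPrimePower q)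
                             (order : Field.HasOrder F (q ℕ.^ 2)) where
  open FieldOfSquareOrder F q q-prime-power order public

  L : Carrier → Carrier → Carrier → Carrier
  L = linearized q

  L-cong : ∀ α₁ α₀ {x y} → x ≈ y → L α₁ α₀ x ≈ L α₁ α₀ y
  L-cong α₁ α₀ x≈y = +-cong (*-congˡ (^-congˡ q x≈y)) (*-congˡ x≈y)

  L-homo-- : ∀ α₁ α₀ x y → L α₁ α₀ (x - y) ≈ L α₁ α₀ x - L α₁ α₀ y
  L-homo-- α₁ α₀ x y = begin
    α₁ * (x - y) ^ q + α₀ * (x - y)     ≈⟨ +-congʳ (*-congˡ (^q-homo-- x y)) ⟩
    α₁ * (x ^ q - y ^ q) + α₀ * (x - y)
      ≈⟨ solve 6 (λ a b X Y x y → a :* (X :- Y) :+ b :* (x :- y) := (a :* X :+ b :* x) :- (a :* Y :+ b :* y)) refl α₁ α₀ (x ^ q) (y ^ q) x y ⟩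
    L α₁ α₀ x - L α₁ α₀ y               ∎

  L[α,αε]≈α*L[1,ε] : ∀ α ε x → L α (α * ε) x ≈ α * L 1# ε x
  L[α,αε]≈α*L[1,ε] α ε x = begin
    α * x ^ q + (α * ε) * x        ≈⟨ solve 4 (λ a X e x → a :* X :+ (a :* e) :* x := a :* (X :+ e :* x)) refl α (x ^ q) ε x ⟩
    α * (x ^ q + ε * x)            ≈⟨ *-congˡ (+-congʳ (*-identityˡ _)) ⟨
    α * (1# * x ^ q + ε * x)       ∎

  L-cong-α₀ : ∀ α₁ {α₀ α₀′} x → α₀ ≈ α₀′ → L α₁ α₀ x ≈ L α₁ α₀′ x
  L-cong-α₀ α₁ x α₀≈α₀′ = +-congˡ (*-congʳ α₀≈α₀′)

  L[1,ε]-on-line : ∀ {ε} → N ε ≈ 1# → ∀ x → L 1# ε x ^ q ≈ ε ^ q * L 1# ε x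
  L[1,ε]-on-line {ε} Nε≈1 x = begin
    (1# * x ^ q + ε * x) ^ q              ≈⟨ ^-congˡ q (+-congʳ (*-identityˡ _)) ⟩
    (x ^ q + ε * x) ^ q                   ≈⟨ ^q-homo-+ (x ^ q) (ε * x) ⟩
    (x ^ q) ^ q + (ε * x) ^ q             ≈⟨ +-cong ([x^q]^q≈x x) (^-distrib-* ε x q) ⟩
    x + ε ^ q * x ^ q                     ≈⟨ +-congʳ (trans (sym (*-identityˡ x)) (*-congʳ (sym Nε≈1))) ⟩
    (ε * ε ^ q) * x + ε ^ q * x ^ q       ≈⟨ solve 4 (λ e E x X → (e :* E) :* x :+ E :* X := E :* (X :+ e :* x)) refl ε (ε ^ q) x (x ^ q) ⟩
    ε ^ q * (x ^ q + ε * x)               ≈⟨ *-congˡ (+-congʳ (*-identityˡ _)) ⟨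
    ε ^ q * (1# * x ^ q + ε * x)          ∎

  *-on-line : ∀ α {λ′ y} → y ^ q ≈ λ′ * y → (α * y) ^ q ≈ (α ^ (q ℕ.∸ 1) * λ′) * (α * y)
  *-on-line α {λ′} {y} y^q≈λ′y = begin
    (α * y) ^ q                  ≈⟨ ^-distrib-* α y q ⟩
    α ^ q * y ^ q                ≈⟨ *-cong (x^q≈x*x^[q∸1] α) y^q≈λ′y ⟩
    (α * α ^ (q ℕ.∸ 1)) * (λ′ * y) ≈⟨ solve 4 (λ a A l y → (a :* A) :* (l :* y) := (A :* l) :* (a :* y)) refl α (α ^ (q ℕ.∸ 1)) λ′ y ⟩
    (α ^ (q ℕ.∸ 1) * λ′) * (α * y) ∎

  L-on-line : ∀ α₁ {α₀ ε} → N ε ≈ 1# → α₀ ≈ α₁ * ε → ∀ x → L α₁ α₀ x ^ q ≈ (α₁ ^ (q ℕ.∸ 1) * ε ^ q) * L α₁ α₀ x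
  L-on-line α₁ {α₀} {ε} Nε≈1 α₀≈α₁ε x = begin
    L α₁ α₀ x ^ q                                ≈⟨ ^-congˡ q L≈α₁L[1,ε] ⟩
    (α₁ * L 1# ε x) ^ q                          ≈⟨ *-on-line α₁ (L[1,ε]-on-line Nε≈1 x) ⟩
    (α₁ ^ (q ℕ.∸ 1) * ε ^ q) * (α₁ * L 1# ε x)   ≈⟨ *-congˡ L≈α₁L[1,ε] ⟨
    (α₁ ^ (q ℕ.∸ 1) * ε ^ q) * L α₁ α₀ x         ∎
    where
    L≈α₁L[1,ε] : L α₁ α₀ x ≈ α₁ * L 1# ε x
    L≈α₁L[1,ε] = trans (L-cong-α₀ α₁ x α₀≈α₁ε) (L[α,αε]≈α*L[1,ε] α₁ ε x)

  L≈0⇒on-line : ∀ {α₁ α₀ ε x} → ¬ α₁ ≈ 0# → α₀ ≈ α₁ * ε → L α₁ α₀ x ≈ 0# → x ^ q ≈ (- ε) * x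
  L≈0⇒on-line {α₁} {α₀} {ε} {x} α₁≉0 α₀≈α₁ε Lx≈0 = begin
    x ^ q                         ≈⟨ solve 2 (λ X y → X := (X :+ y) :- y) refl (x ^ q) (ε * x) ⟩
    (x ^ q + ε * x) - ε * x       ≈⟨ +-congʳ (trans (+-congʳ (sym (*-identityˡ _))) L[1,ε]x≈0) ⟩
    0# - ε * x                    ≈⟨ +-identityˡ _ ⟩
    - (ε * x)                     ≈⟨ solve 2 (λ e x → :- (e :* x) := (:- e) :* x) refl ε x ⟩
    (- ε) * x                     ∎
    where
    L[1,ε]x≈0 : L 1# ε x ≈ 0#
    L[1,ε]x≈0 = *-cancelˡ-≈0 α₁≉0 (trans (sym (L[α,αε]≈α*L[1,ε] α₁ ε x)) (trans (sym (L-cong-α₀ α₁ x α₀≈α₁ε)) Lx≈0))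

  HasRank-1-if : ∀ {α₁ α₀ ε} → ¬ α₁ ≈ 0# → N ε ≈ 1# → α₀ ≈ α₁ * ε → HasRank q (L α₁ α₀) 1
  HasRank-1-if {α₁} {α₀} {ε} α₁≉0 Nε≈1 α₀≈α₁ε =
    image , ≡.trans (ℕ.≤-antisym |image|≤q q≤|image|) (≡.sym (ℕ.*-identityʳ q)) ,
    elementsWhere-Unique image?′ , elementsWhere-sound image?′ ,
    λ _ → elementsWhere-complete image?′ (image-resp (L α₁ α₀))
    where
    image?′ : Decidable (λ y → ∃ λ x → L α₁ α₀ x ≈ y)
    image?′ = image? (L α₁ α₀) (L-cong α₁ α₀)
    image kernel : List Carrier
    image  = elementsWhere image?′
    kernel = elementsWhere (λ x → L α₁ α₀ x ≟ 0#)
    |image|≤q : length image ≤ q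
    |image|≤q = solutions-x^q≈a*x-≤q (α₁ ^ (q ℕ.∸ 1) * ε ^ q) (elementsWhere-Unique _)
      (All.map (λ (x , Lx≈y) → trans (^-congˡ q (sym Lx≈y)) (trans (L-on-line α₁ Nε≈1 α₀≈α₁ε x) (*-congˡ Lx≈y)))
               (elementsWhere-sound _))
    |kernel|≤q : length kernel ≤ q
    |kernel|≤q = solutions-x^q≈a*x-≤q (- ε) (elementsWhere-Unique _)
      (All.map (L≈0⇒on-line α₁≉0 α₀≈α₁ε) (elementsWhere-sound _))
    q≤|image| : q ≤ length image
    q≤|image| = ℕ.*-cancelʳ-≤ q (length image) q {{ℕ.>-nonZero (ℕ.<-trans (s≤s z≤n) (IsPrimePower⇒2≤ q-prime-power))}}
      (ℕ.≤-trans (ℕ.≤-reflexive (≡.cong (q ℕ.*_) (≡.sym (ℕ.*-identityʳ q))))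
        (ℕ.≤-trans (|E|≤|image|*|kernel| (L α₁ α₀) (L-homo-- α₁ α₀) (elementsWhere-Unique _)
                      (λ x → elementsWhere-complete _ (image-resp (L α₁ α₀)) (x , refl)) (elementsWhere-sound _)
                      (elementsWhere-complete _ (λ x≈y Lx≈0 → trans (L-cong α₁ α₀ (sym x≈y)) Lx≈0)))
                   (ℕ.*-monoʳ-≤ (length image) |kernel|≤q)))

  L^q≈α₁^q*x+α₀^q*x^q : ∀ α₁ α₀ z → L α₁ α₀ z ^ q ≈ α₁ ^ q * z + α₀ ^ q * z ^ q
  L^q≈α₁^q*x+α₀^q*x^q α₁ α₀ z = begin
    (α₁ * z ^ q + α₀ * z) ^ q           ≈⟨ ^q-homo-+ _ _ ⟩
    (α₁ * z ^ q) ^ q + (α₀ * z) ^ q     ≈⟨ +-cong (^-distrib-* _ _ q) (^-distrib-* _ _ q) ⟩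
    α₁ ^ q * (z ^ q) ^ q + α₀ ^ q * z ^ q ≈⟨ +-congʳ (*-congˡ ([x^q]^q≈x z)) ⟩
    α₁ ^ q * z + α₀ ^ q * z ^ q         ∎

  N≉N⇒L-injective : ∀ {α₁ α₀} → ¬ N α₁ - N α₀ ≈ 0# → ∀ x y → L α₁ α₀ x ≈ L α₁ α₀ y → x ≈ y
  N≉N⇒L-injective {α₁} {α₀} d≉0 x y Lx≈Ly = x-y≈0⇒x≈y x y (*-cancelˡ-≈0 d≉0 (begin
    (N α₁ - N α₀) * z ≈⟨ solve 6 (λ a b A B z Z → (a :* A :- b :* B) :* z := a :* (A :* z :+ B :* Z) :- B :* (a :* Z :+ b :* z))
                                   refl α₁ α₀ (α₁ ^ q) (α₀ ^ q) z (z ^ q) ⟩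
    α₁ * (α₁ ^ q * z + α₀ ^ q * z ^ q) - α₀ ^ q * L α₁ α₀ z
      ≈⟨ +-cong (*-congˡ (trans (sym (L^q≈α₁^q*x+α₀^q*x^q α₁ α₀ z)) (^-congˡ q Lz≈0))) (-‿cong (*-congˡ Lz≈0)) ⟩
    α₁ * 0# ^ q - α₀ ^ q * 0#            ≈⟨ +-cong (trans (*-congˡ 0^q≈0) (zeroʳ _)) (-‿cong (zeroʳ _)) ⟩
    0# - 0#                               ≈⟨ -‿inverseʳ 0# ⟩
    0#                                    ∎))
    where
    z : Carrier
    z = x - y
    Lz≈0 : L α₁ α₀ z ≈ 0#
    Lz≈0 = trans (L-homo-- α₁ α₀ x y) (x≈y⇒x-y≈0 Lx≈Ly)

  HasRank-1⇒N≈N : ∀ {α₁ α₀} → HasRank q (L α₁ α₀) 1 → N α₀ ≈ N α₁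
  HasRank-1⇒N≈N {α₁} {α₀} (R , |R|≡q^1 , R! , _ , R-complete) with N α₁ - N α₀ ≟ 0#
  ... | yes d≈0 = sym (x-y≈0⇒x≈y _ _ d≈0)
  ... | no  d≉0 = ⊥-elim (ℕ.<⇒≱ q<q^2 (≡.subst₂ _≤_ length-E (≡.trans |R|≡q^1 (ℕ.*-identityʳ q))
                    (Unique-⊆⇒length≤ E-Unique (λ {y} _ → R-complete y (injective⇒surjective _ (N≉N⇒L-injective d≉0) y)))))

  HasRank-1⇒α₁≉0 : ∀ {α₁ α₀} → HasRank q (L α₁ α₀) 1 → ¬ α₁ ≈ 0#
  HasRank-1⇒α₁≉0 {α₁} {α₀} rank@(R , |R|≡q^1 , R! , R-sound , _) α₁≈0 =
    ℕ.<⇒≱ (IsPrimePower⇒2≤ q-prime-power) (≡.subst (_≤ 1) (≡.trans |R|≡q^1 (ℕ.*-identityʳ q))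
      (Unique-⊆⇒length≤ {ys = 0# ∷ []} R! (All-∈⇒⊆ (All.map (λ (x , Lx≈y) → here (trans (sym Lx≈y) (L≈0 x))) R-sound))))
    where
    α₀≈0 : α₀ ≈ 0#
    α₀≈0 = x^m≈0⇒x≈0 (suc q) (trans (HasRank-1⇒N≈N rank) (trans (*-congʳ α₁≈0) (zeroˡ _)))
    L≈0 : ∀ x → L α₁ α₀ x ≈ 0#
    L≈0 x = trans (+-cong (trans (*-congʳ α₁≈0) (zeroˡ _)) (trans (*-congʳ α₀≈0) (zeroˡ _))) (+-identityʳ 0#)

  HasRank-1⇒α₀≈α₁ε : ∀ {α₁ α₀} → HasRank q (L α₁ α₀) 1 → ∃ λ ε → α₀ ≈ α₁ * ε × N ε ≈ 1#
  HasRank-1⇒α₀≈α₁ε {α₁} {α₀} rank = α₀ * α₁⁻¹ , α₀≈α₁ε , (begin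
    N (α₀ * α₁⁻¹)        ≈⟨ N-homo-* α₀ α₁⁻¹ ⟩
    N α₀ * N α₁⁻¹        ≈⟨ *-congʳ (HasRank-1⇒N≈N rank) ⟩
    N α₁ * N α₁⁻¹        ≈⟨ N-homo-* α₁ α₁⁻¹ ⟨
    N (α₁ * α₁⁻¹)        ≈⟨ ^-congˡ (suc q) (x*x⁻¹≈1 α₁ α₁≉0) ⟩
    N 1#                 ≈⟨ 1^n≈1 (suc q) ⟩
    1#                   ∎)
    where
    α₁≉0 : ¬ α₁ ≈ 0#
    α₁≉0 = HasRank-1⇒α₁≉0 rank
    α₁⁻¹ : Carrier
    α₁⁻¹ = (α₁ ⁻¹) α₁≉0
    α₀≈α₁ε : α₀ ≈ α₁ * (α₀ * α₁⁻¹)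
    α₀≈α₁ε = begin
      α₀                 ≈⟨ *-identityʳ α₀ ⟨
      α₀ * 1#            ≈⟨ *-congˡ (x*x⁻¹≈1 α₁ α₁≉0) ⟨
      α₀ * (α₁ * α₁⁻¹)   ≈⟨ solve 3 (λ b a i → b :* (a :* i) := a :* (b :* i)) refl α₀ α₁ α₁⁻¹ ⟩
      α₁ * (α₀ * α₁⁻¹)   ∎

module PermutationPolynomials {c ℓ} (F : Field c ℓ) (q : ℕ) (q-prime-power : IsPrimePower q)
    (order : Field.HasOrder F (q ℕ.^ 2))
    (δ : Field.Carrier F) (Nδ≈1 : Field._≈_ F (Field._^_ F δ (suc q)) (Field.1# F))
    (m : ℕ) (1≤m : 1 ≤ m) (m⊥q∸1 : Data.Nat.GCD.gcd m (q ℕ.∸ 1) ≡ 1) where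
  open LinearizedPolynomials F q q-prime-power order public

  s : Carrier → Carrier
  s = L 1# δ

  sᵐ+L : Carrier → Carrier → Carrier → Carrier
  sᵐ+L α₁ α₀ x = s x ^ m + L α₁ α₀ x

  Δ : Carrier
  Δ = (δ ^ q) ^ m

  s-on-line : ∀ x → s x ^ q ≈ δ ^ q * s x
  s-on-line = L[1,ε]-on-line Nδ≈1

  ^m-on-line : ∀ {a} → a ^ q ≈ δ ^ q * a → (a ^ m) ^ q ≈ Δ * a ^ m
  ^m-on-line {a} a^q≈δ^qa = begin
    (a ^ m) ^ q     ≈⟨ ^-comm a m q ⟩
    (a ^ q) ^ m     ≈⟨ ^-congˡ m a^q≈δ^qa ⟩
    (δ ^ q * a) ^ m ≈⟨ ^-distrib-* _ _ m ⟩
    Δ * a ^ m       ∎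

  on-line⇒x^[q∸1]≈δ^q : ∀ {x} → ¬ x ≈ 0# → x ^ q ≈ δ ^ q * x → x ^ (q ℕ.∸ 1) ≈ δ ^ q
  on-line⇒x^[q∸1]≈δ^q {x} x≉0 x-on-line = *-cancelˡ x≉0 (trans (sym (x^q≈x*x^[q∸1] x)) (trans x-on-line (*-comm _ _)))

  ^m-injective-on-line : ∀ {a b} → a ^ q ≈ δ ^ q * a → b ^ q ≈ δ ^ q * b → a ^ m ≈ b ^ m → a ≈ b
  ^m-injective-on-line {a} {b} a-on-line b-on-line a^m≈b^m with a ≟ 0# | b ≟ 0#
  ... | yes a≈0 | _       = trans a≈0 (sym (x^m≈0⇒x≈0 m (trans (sym a^m≈b^m) (x≈0⇒x^n≈0 1≤m a≈0))))
  ... | no  a≉0 | yes b≈0 = ⊥-elim (a≉0 (x^m≈0⇒x≈0 m (trans a^m≈b^m (x≈0⇒x^n≈0 1≤m b≈0))))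
  ... | no  a≉0 | no  b≉0 = coprime-^-injective {m} {q ℕ.∸ 1} m⊥q∸1 a≉0 a^m≈b^m
    (trans (on-line⇒x^[q∸1]≈δ^q a≉0 a-on-line) (sym (on-line⇒x^[q∸1]≈δ^q b≉0 b-on-line)))

  α^[q∸1]*ε^q≈Δ⇒α^[q∸1]≈Δ*ε : ∀ {α ε} → N ε ≈ 1# → α ^ (q ℕ.∸ 1) * ε ^ q ≈ Δ → α ^ (q ℕ.∸ 1) ≈ Δ * ε
  α^[q∸1]*ε^q≈Δ⇒α^[q∸1]≈Δ*ε {α} {ε} Nε≈1 α^[q∸1]ε^q≈Δ = begin
    α ^ (q ℕ.∸ 1)                ≈⟨ *-identityʳ _ ⟨
    α ^ (q ℕ.∸ 1) * 1#           ≈⟨ *-congˡ (trans (*-comm _ _) Nε≈1) ⟨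
    α ^ (q ℕ.∸ 1) * (ε ^ q * ε)  ≈⟨ *-assoc _ _ _ ⟨
    (α ^ (q ℕ.∸ 1) * ε ^ q) * ε  ≈⟨ *-congʳ α^[q∸1]ε^q≈Δ ⟩
    Δ * ε                        ∎

  α^[q∸1]≈Δ*ε⇒α^[q∸1]*ε^q≈Δ : ∀ {α ε} → N ε ≈ 1# → α ^ (q ℕ.∸ 1) ≈ Δ * ε → α ^ (q ℕ.∸ 1) * ε ^ q ≈ Δ
  α^[q∸1]≈Δ*ε⇒α^[q∸1]*ε^q≈Δ {α} {ε} Nε≈1 α^[q∸1]≈Δε = begin
    α ^ (q ℕ.∸ 1) * ε ^ q ≈⟨ *-congʳ α^[q∸1]≈Δε ⟩
    (Δ * ε) * ε ^ q       ≈⟨ *-assoc _ _ _ ⟩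
    Δ * N ε               ≈⟨ *-congˡ Nε≈1 ⟩
    Δ * 1#                ≈⟨ *-identityʳ _ ⟩
    Δ                     ∎

  sᵐ+L-injective : ∀ {α₁ ε} → ¬ α₁ ≈ 0# → N ε ≈ 1# → ¬ ε ≈ δ → ¬ α₁ ^ (q ℕ.∸ 1) ≈ Δ * ε →
                   ∀ x y → sᵐ+L α₁ (α₁ * ε) x ≈ sᵐ+L α₁ (α₁ * ε) y → x ≈ y
  sᵐ+L-injective {α₁} {ε} α₁≉0 Nε≈1 ε≉δ α₁^[q∸1]≉Δε x y fx≈fy = sym (x-y≈0⇒x≈y y x z≈0)
    where
    λ′ : Carrier
    λ′ = α₁ ^ (q ℕ.∸ 1) * ε ^ q
    D : Carrier
    D = s x ^ m - s y ^ m
    z : Carrier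
    z = y - x
    D≈Lz : D ≈ L α₁ (α₁ * ε) z
    D≈Lz = begin
      s x ^ m - s y ^ m                 ≈⟨ solve 3 (λ A B X → A :- B := (A :+ X) :- B :- X) refl (s x ^ m) (s y ^ m) (L α₁ (α₁ * ε) x) ⟩
      sᵐ+L α₁ (α₁ * ε) x - s y ^ m - L α₁ (α₁ * ε) x ≈⟨ +-congʳ (+-congʳ fx≈fy) ⟩
      sᵐ+L α₁ (α₁ * ε) y - s y ^ m - L α₁ (α₁ * ε) x ≈⟨ solve 3 (λ B Y X → (B :+ Y) :- B :- X := Y :- X) refl (s y ^ m) _ _ ⟩
      L α₁ (α₁ * ε) y - L α₁ (α₁ * ε) x ≈⟨ L-homo-- α₁ (α₁ * ε) y x ⟨
      L α₁ (α₁ * ε) z                   ∎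
    D≈0 : D ≈ 0#
    D≈0 = ay≈by⇒y≈0 (α₁^[q∸1]≉Δε ∘ α^[q∸1]*ε^q≈Δ⇒α^[q∸1]≈Δ*ε Nε≈1 ∘ sym) (begin
      Δ * D                         ≈⟨ solve 3 (λ d A B → d :* (A :- B) := d :* A :- d :* B) refl Δ (s x ^ m) (s y ^ m) ⟩
      Δ * s x ^ m - Δ * s y ^ m     ≈⟨ +-cong (^m-on-line (s-on-line x)) (-‿cong (^m-on-line (s-on-line y))) ⟨
      (s x ^ m) ^ q - (s y ^ m) ^ q ≈⟨ ^q-homo-- _ _ ⟨
      D ^ q                         ≈⟨ ^-congˡ q D≈Lz ⟩
      L α₁ (α₁ * ε) z ^ q           ≈⟨ L-on-line α₁ Nε≈1 refl z ⟩
      λ′ * L α₁ (α₁ * ε) z          ≈⟨ *-congˡ D≈Lz ⟨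
      λ′ * D                        ∎)
    sz≈0 : s z ≈ 0#
    sz≈0 = trans (L-homo-- 1# δ y x) (x≈y⇒x-y≈0 (sym (^m-injective-on-line (s-on-line x) (s-on-line y) (x-y≈0⇒x≈y _ _ D≈0))))
    z≈0 : z ≈ 0#
    z≈0 = ay≈by⇒y≈0 (ε≉δ ∘ sym ∘ -‿injective)
      (trans (sym (L≈0⇒on-line 1≉0 (sym (*-identityˡ δ)) sz≈0)) (L≈0⇒on-line α₁≉0 refl (trans (sym D≈Lz) D≈0)))

  α₀≈α₁δ⇒¬injective : ∀ {α₁ α₀} → α₀ ≈ α₁ * δ → ¬ (∀ x y → sᵐ+L α₁ α₀ x ≈ sᵐ+L α₁ α₀ y → x ≈ y)
  α₀≈α₁δ⇒¬injective {α₁} {α₀} α₀≈α₁δ f-injective =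
    ¬surjective-onto-line s (δ ^ q) s-on-line (injective⇒surjective s s-injective)
    where
    L≈α₁s : ∀ x → L α₁ α₀ x ≈ α₁ * s x
    L≈α₁s x = trans (L-cong-α₀ α₁ x α₀≈α₁δ) (L[α,αε]≈α*L[1,ε] α₁ δ x)
    s-injective : ∀ x y → s x ≈ s y → x ≈ y
    s-injective x y sx≈sy = f-injective x y
      (+-cong (^-congˡ m sx≈sy) (trans (L≈α₁s x) (trans (*-congˡ sx≈sy) (sym (L≈α₁s y)))))

  α₁^[q∸1]≈Δε⇒¬surjective : ∀ {α₁ α₀ ε} → N ε ≈ 1# → α₀ ≈ α₁ * ε → α₁ ^ (q ℕ.∸ 1) ≈ Δ * ε →
                              ¬ (∀ y → ∃ λ x → sᵐ+L α₁ α₀ x ≈ y)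
  α₁^[q∸1]≈Δε⇒¬surjective {α₁} {α₀} {ε} Nε≈1 α₀≈α₁ε α₁^[q∸1]≈Δε = ¬surjective-onto-line (sᵐ+L α₁ α₀) Δ λ x → begin
    (s x ^ m + L α₁ α₀ x) ^ q                          ≈⟨ ^q-homo-+ _ _ ⟩
    (s x ^ m) ^ q + L α₁ α₀ x ^ q                      ≈⟨ +-cong (^m-on-line (s-on-line x)) (L-on-line α₁ Nε≈1 α₀≈α₁ε x) ⟩
    Δ * s x ^ m + (α₁ ^ (q ℕ.∸ 1) * ε ^ q) * L α₁ α₀ x ≈⟨ +-congˡ (*-congʳ (α^[q∸1]≈Δ*ε⇒α^[q∸1]*ε^q≈Δ Nε≈1 α₁^[q∸1]≈Δε)) ⟩
    Δ * s x ^ m + Δ * L α₁ α₀ x                        ≈⟨ distribˡ _ _ _ ⟨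
    Δ * (s x ^ m + L α₁ α₀ x)                          ∎


  Admissible : Carrier → Carrier → Set ℓ
  Admissible ε α = ¬ α ≈ 0# × ¬ α ^ (q ℕ.∸ 1) ≈ Δ * ε

  rank-1-permutation-if : ∀ {ε α} → N ε ≈ 1# → ¬ ε ≈ δ → Admissible ε α →
                          HasRank q (L α (α * ε)) 1 × IsBijection (sᵐ+L α (α * ε))
  rank-1-permutation-if {ε} {α} Nε≈1 ε≉δ (α≉0 , α^[q∸1]≉Δε) =
    HasRank-1-if α≉0 Nε≈1 refl , f-injective , injective⇒surjective _ f-injective
    where
    f-injective : ∀ x y → sᵐ+L α (α * ε) x ≈ sᵐ+L α (α * ε) y → x ≈ y
    f-injective = sᵐ+L-injective α≉0 Nε≈1 ε≉δ α^[q∸1]≉Δε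

  rank-1-permutation⇒ : ∀ {α₁ α₀} → HasRank q (L α₁ α₀) 1 → IsBijection (sᵐ+L α₁ α₀) →
                        ∃ λ ε → N ε ≈ 1# × ¬ ε ≈ δ × Admissible ε α₁ × α₀ ≈ α₁ * ε
  rank-1-permutation⇒ {α₁} {α₀} rank (f-injective , f-surjective) =
    let ε , α₀≈α₁ε , Nε≈1 = HasRank-1⇒α₀≈α₁ε rank in
    ε , Nε≈1 ,
    (λ ε≈δ → α₀≈α₁δ⇒¬injective (trans α₀≈α₁ε (*-congˡ ε≈δ)) f-injective) ,
    (HasRank-1⇒α₁≉0 rank , λ α₁^[q∸1]≈Δε → α₁^[q∸1]≈Δε⇒¬surjective Nε≈1 α₀≈α₁ε α₁^[q∸1]≈Δε f-surjective) ,
    α₀≈α₁ε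

  N[Δ*ε]≈1 : ∀ {ε} → N ε ≈ 1# → N (Δ * ε) ≈ 1#
  N[Δ*ε]≈1 {ε} Nε≈1 = begin
    N (Δ * ε)                 ≈⟨ N-homo-* Δ ε ⟩
    N ((δ ^ q) ^ m) * N ε     ≈⟨ *-cong (trans (^-comm (δ ^ q) m (suc q)) (^-congˡ m (^-comm δ q (suc q)))) Nε≈1 ⟩
    ((N δ) ^ q) ^ m * 1#      ≈⟨ *-congʳ (trans (^-congˡ m (trans (^-congˡ q Nδ≈1) (1^n≈1 q))) (1^n≈1 m)) ⟩
    1# * 1#                   ≈⟨ *-identityʳ 1# ⟩
    1#                        ∎

  εs : List Carrier
  εs = filter (∁? (δ ≟_)) normOne

  αs : Carrier → List Carrier
  αs ε = filter (∁? (λ α → α ^ (q ℕ.∸ 1) ≟ Δ * ε)) units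

  length-εs : length εs ≡ q
  length-εs = ℕ.suc-injective (≡.trans (≡.cong (ℕ._+ length εs) (≡.sym |δ|≡1))
    (≡.trans (length-filter+length-filter-∁ (δ ≟_) normOne) length-normOne))
    where
    |δ|≡1 : length (filter (δ ≟_) normOne) ≡ 1
    |δ|≡1 = length-filter-≈ (elementsWhere-Unique _) (elementsWhere-complete _ N≈1-resp Nδ≈1)

  length-αs : ∀ {ε} → N ε ≈ 1# → length (αs ε) ≡ (q ℕ.∸ 1) ℕ.* q
  length-αs {ε} Nε≈1 = ℕ.+-cancelˡ-≡ (q ℕ.∸ 1) _ _
    (≡.trans (≡.cong (ℕ._+ length (αs ε)) (≡.sym (length-fibre-x^[q∸1] (N[Δ*ε]≈1 Nε≈1))))
    (≡.trans (length-filter+length-filter-∁ _ units)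
    (≡.trans length-units (ℕ.*-suc (q ℕ.∸ 1) q))))

  private
    εs-N≈1 : All (λ ε → N ε ≈ 1#) εs
    εs-N≈1 = All.filter⁺ _ (elementsWhere-sound _)

    εs-≉δ : All (λ ε → ¬ δ ≈ ε) εs
    εs-≉δ = All.all-filter _ normOne

    αs-≉0 : ∀ ε → All (λ α → ¬ α ≈ 0#) (αs ε)
    αs-≉0 ε = All.filter⁺ _ (elementsWhere-sound _)

    αs-Admissible : ∀ ε → All (Admissible ε) (αs ε)
    αs-Admissible ε = All.zipWith (λ x → x) (αs-≉0 ε , All.all-filter _ units)

  coefficients : Carrier → List (Carrier × Carrier)
  coefficients ε = map (λ α → α , α * ε) (αs ε)

  solutions : List (Carrier × Carrier)
  solutions = List.concatMap coefficients εs

  length-solutions : length solutions ≡ q ℕ.^ 2 ℕ.* (q ℕ.∸ 1)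
  length-solutions = ≡.trans
    (length-concatMap coefficients εs (All.map (λ {ε} Nε≈1 → ≡.trans (List.length-map _ (αs ε)) (length-αs Nε≈1)) εs-N≈1))
    (≡.trans (≡.cong (ℕ._* _) length-εs) (a*[b*a]≡a^2*b q (q ℕ.∸ 1)))

  solutions-sound : All (λ (α₁ , α₀) → HasRank q (L α₁ α₀) 1 × IsBijection (sᵐ+L α₁ α₀)) solutions
  solutions-sound = All.concat⁺ (All.map⁺ (All.zipWith
    (λ {ε} (Nε≈1 , δ≉ε) → All.map⁺ (All.map (rank-1-permutation-if Nε≈1 (δ≉ε ∘ sym)) (αs-Admissible ε)))
    (εs-N≈1 , εs-≉δ)))

  private
    module S² = UniqueLists (×-setoid setoid setoid)

    All-resp-∈ : ∀ {P : Carrier → Set ℓ} → (∀ {x y} → x ≈ y → P y → P x) → ∀ {x xs} → All P xs → x ∈ xs → P x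
    All-resp-∈ P-resp Pxs x∈xs = let Py , x≈y = All.lookupAny Pxs x∈xs in P-resp x≈y Py

    coefficients-disjoint : ∀ {ε ε′} → ¬ ε ≈ ε′ → ∀ {v} → ¬ (v S².∈ coefficients ε × v S².∈ coefficients ε′)
    coefficients-disjoint {ε} {ε′} ε≉ε′ (v∈ , v∈′) =
      let α  , α∈  , (v₁≈α  , v₂≈αε)   = SetoidMembershipₚ.∈-map⁻ setoid (×-setoid setoid setoid) v∈
          α′ , α′∈ , (v₁≈α′ , v₂≈α′ε′) = SetoidMembershipₚ.∈-map⁻ setoid (×-setoid setoid setoid) v∈′
          α≉0 = All-resp-∈ (λ x≈y y≉0 → ≉0-resp (sym x≈y) y≉0) (αs-≉0 ε) α∈
      in ε≉ε′ (*-cancelˡ α≉0 (trans (sym v₂≈αε) (trans v₂≈α′ε′ (*-congʳ (trans (sym v₁≈α′) v₁≈α)))))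

  solutions-Unique : S².Unique solutions
  solutions-Unique = SetoidUniqueₚ.concat⁺ (×-setoid setoid setoid)
    (All.map⁺ (All.tabulate λ {ε} _ → SetoidUniqueₚ.map⁺ setoid (×-setoid setoid setoid) proj₁
                                         (SetoidUniqueₚ.filter⁺ setoid _ (elementsWhere-Unique _))))
    (AllPairsₚ.map⁺ (AllPairs.map coefficients-disjoint (SetoidUniqueₚ.filter⁺ setoid _ (elementsWhere-Unique _))))

  solutions-complete : ∀ {α₁ α₀} → HasRank q (L α₁ α₀) 1 → IsBijection (sᵐ+L α₁ α₀) → (α₁ , α₀) S².∈ solutions
  solutions-complete {α₁} {α₀} rank bijection =
    let ε , Nε≈1 , ε≉δ , (α₁≉0 , α₁^[q∸1]≉Δε) , α₀≈α₁ε = rank-1-permutation⇒ rank bijection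
        ε∈εs = SetoidMembershipₚ.∈-filter⁺ setoid (∁? (δ ≟_)) (λ ε≈ε′ δ≉ε → δ≉ε ∘ (λ δ≈ε′ → trans δ≈ε′ (sym ε≈ε′)))
                 (elementsWhere-complete _ N≈1-resp Nε≈1) (ε≉δ ∘ sym)
    in SetoidMembershipₚ.∈-concatMap⁺ setoid (×-setoid setoid setoid) (Any.map (λ {ε′} ε≈ε′ →
         SetoidMembershipₚ.∈-resp-≈ (×-setoid setoid setoid) (refl , sym (trans α₀≈α₁ε (*-congˡ ε≈ε′)))
           (SetoidMembershipₚ.∈-map⁺ setoid (×-setoid setoid setoid) (λ α≈α′ → α≈α′ , *-congʳ α≈α′)
             (SetoidMembershipₚ.∈-filter⁺ setoid _ (λ α≈α′ ¬bad bad → ¬bad (trans (^-congˡ (q ℕ.∸ 1) α≈α′) bad))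
               (elementsWhere-complete _ ≉0-resp α₁≉0)
               (λ bad → α₁^[q∸1]≉Δε (trans bad (*-congˡ (sym ε≈ε′))))))) ε∈εs)

open import Data.Nat using (_>_; _∸_; _*_; _^_; _+_)
open import Data.Nat.GCD using (gcd)

corollary2 : ∀ {c ℓ} (q : ℕ) → IsPrimePower q → (F : Field c ℓ) → Field.HasOrder F (q ^ 2)
    → (δ : Field.Carrier F) → Field._≈_ F (Field._^_ F δ (q + 1)) (Field.1# F)
    → (m : ℕ) → m > 1 → gcd m (q ∸ 1) ≡ 1
    → HasCard (Field._≈²_ F)
        (λ { (α₁ , α₀) →
            Field.HasRank F q (Field.linearized F q α₁ α₀) 1
            × Field.IsBijection F (λ x →
                Field._+_ F (Field._^_ F (Field.linearized F q (Field.1# F) δ x) m)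
                            (Field.linearized F q α₁ α₀ x)) })
        (q ^ 2 * (q ∸ 1))
corollary2 q q-prime-power F order δ δ^[q+1]≈1 m m>1 m⊥q∸1 =
  solutions , length-solutions , solutions-Unique , solutions-sound ,
  λ _ (rank , bijection) → solutions-complete rank bijection
  where
  open PermutationPolynomials F q q-prime-power order δ
         (≡.subst (λ k → Field._≈_ F (Field._^_ F δ k) (Field.1# F)) (ℕ.+-comm q 1) δ^[q+1]≈1)
         m (ℕ.<⇒≤ m>1) m⊥q∸1
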